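{- For $w\in\mathbb C$, $w\neq1$, and $v\in\mathbb C$, we have $U_0(w;v)=\tilde U_0(w;v)$ and, for all $r\ge1$, $$U_r(w;v)=\tilde U_r(w;v)+v\,\tilde U_{r-1}(w;v).$$
   Context: De Moivre polynomials: for integers $n$ and $k\ge0$, $\mathcal A_{n,k}(a_1,a_2,\dots)$ is defined by $(a_1x+a_2x^2+\cdots)^k=\sum_{n\in\mathbb Z}\mathcal A_{n,k}(a_1,a_2,\dots)x^n$. $\binom{v}{j}$ is the generalized binomial coefficient; $\delta$ is the Kronecker delta. Define $U_r(w;v)=\delta_{r,0}-\sum_{m=0}^r(-1)^m\binom{v}{r-m}\sum_{k=0}^m\frac{w}{(w-1)^{r+k+1}}\frac{(r+k)!}{k!}\mathcal A_{m,k}(\tfrac12,\tfrac13,\tfrac14,\dots)$, $\tilde U_r(w;v)=-\sum_{m=0}^r\frac{v^{r-m}}{(r-m)!}\sum_{k=0}^m\frac{(-w)^k}{(w-1)^{r+k+1}}\frac{(r+k)!}{k!}\mathcal A_{m,k}(\tfrac1{2!},\tfrac1{3!},\tfrac1{4!},\dots)$. -}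

module Defs where

open import Level using (Level; _⊔_)
open import Algebra.Bundles using (CommutativeRing)
open import Data.Nat as ℕ using (ℕ; zero; suc; _∸_; _!)
open import Relation.Nullary using (¬_)

-- A field of characteristic zero (C is the intended instance).  The inverse is
-- total (0⁻¹ is an unconstrained junk value); only its behaviour on nonzero
-- elements is specified.
-- canonical image of ℕ in a commutative ring: ofℕ n = 1 + 1 + ⋯ + 1
ofℕ : ∀ {c ℓ} (R : CommutativeRing c ℓ) → ℕ → CommutativeRing.Carrier R
ofℕ R zero    = CommutativeRing.0# R
ofℕ R (suc n) = CommutativeRing._+_ R (CommutativeRing.1# R) (ofℕ R n)

record CharZeroField (c ℓ : Level) : Set (Level.suc (c ⊔ ℓ)) where
  field
    commutativeRing : CommutativeRing c ℓ
  open CommutativeRing commutativeRing public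
  field
    _⁻¹        : Carrier → Carrier
    ⁻¹-cong    : ∀ {x y} → x ≈ y → x ⁻¹ ≈ y ⁻¹
    inverseʳ   : ∀ x → ¬ (x ≈ 0#) → x * (x ⁻¹) ≈ 1#
    0≉1        : ¬ (0# ≈ 1#)
    charZero   : ∀ n → ¬ (ofℕ commutativeRing (suc n) ≈ 0#)

module WithField {c ℓ : Level} (F : CharZeroField c ℓ) where
  open CharZeroField F

  ofℕF : ℕ → Carrier
  ofℕF = ofℕ commutativeRing

  infixl 7 _÷_
  _÷_ : Carrier → Carrier → Carrier
  x ÷ y = x * (y ⁻¹)

  _^_ : Carrier → ℕ → Carrier
  x ^ zero  = 1#
  x ^ suc n = x * (x ^ n)

  Σ< : ℕ → (ℕ → Carrier) → Carrier
  Σ< zero    f = 0#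
  Σ< (suc n) f = Σ< n f + f n

  Σ≤ : ℕ → (ℕ → Carrier) → Carrier
  Σ≤ n f = Σ< (suc n) f

  δ : ℕ → ℕ → Carrier
  δ zero    zero    = 1#
  δ zero    (suc n) = 0#
  δ (suc m) zero    = 0#
  δ (suc m) (suc n) = δ m n

  fallingProd : Carrier → ℕ → Carrier
  fallingProd v zero    = 1#
  fallingProd v (suc j) = fallingProd v j * (v - ofℕF j)

  binom : Carrier → ℕ → Carrier
  binom v j = fallingProd v j ÷ ofℕF (j !)

  Series : Set c
  Series = ℕ → Carrier

  _⊛_ : Series → Series → Series
  (f ⊛ g) n = Σ≤ n (λ i → f i * g (n ∸ i))

  oneS : Series
  oneS n = δ n 0

  powS : Series → ℕ → Series
  powS f zero    = oneS
  powS f (suc k) = f ⊛ powS f k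

  -- the series a₁x + a₂x² + ⋯ from a sequence a (a i is the coefficient a_i, i ≥ 1)
  seriesOf : (ℕ → Carrier) → Series
  seriesOf a zero    = 0#
  seriesOf a (suc i) = a (suc i)

  A : ℕ → ℕ → (ℕ → Carrier) → Carrier
  A n k a = powS (seriesOf a) k n

  harm : ℕ → Carrier
  harm i = 1# ÷ ofℕF (suc i)

  invFact : ℕ → Carrier
  invFact i = 1# ÷ ofℕF (suc i !)

  ratFact : ℕ → ℕ → Carrier
  ratFact r k = ofℕF ((r ℕ.+ k) !) ÷ ofℕF (k !)

  U : ℕ → Carrier → Carrier → Carrier
  U r w v = δ r 0 - Σ≤ r (λ m →
      ((- 1#) ^ m) * binom v (r ∸ m) *
      Σ≤ m (λ k → (w ÷ ((w - 1#) ^ (r ℕ.+ k ℕ.+ 1))) * ratFact r k * A m k harm))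

  Ũ : ℕ → Carrier → Carrier → Carrier
  Ũ r w v = - Σ≤ r (λ m →
      ((v ^ (r ∸ m)) ÷ ofℕF ((r ∸ m) !)) *
      Σ≤ m (λ k → (((- w) ^ k) ÷ ((w - 1#) ^ (r ℕ.+ k ℕ.+ 1))) * ratFact r k * A m k invFact))

{-# OPTIONS --safe #-}
module Submission where

-- Let eₜ = (eˣ - 1 - x)/x and eᵣ = (-log(1 - x) - x)/x.  Expanding the composites by
-- De Moivre polynomials, Ũ r = -T r v with T r v the coefficient of xʳ in
-- r!(w - 1 + w eₜ)^-(r+1) e^(vx), and U r = δ r 0 - w R r v with R r v the coefficient
-- of xʳ in (-1)ʳ r!(w - 1 - eᵣ)^-(r+1) (1 - x)^v.  Since x(w - 1 + w eₜ) and
-- x(w - 1 - eᵣ) have derivatives w eˣ - 1 and w - 1/(1 - x), the Leibniz rule yields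
--   w T (r+1) (v+1) = T (r+1) v + v T r v,   w R (r+1) (v+1) = R (r+1) v + (v+1) R r v.
-- So R r u and T r (u+1) are polynomials of degree ≤ r in u obeying the same recurrence,
-- and their difference Z satisfies w Z(u+1) = Z(u); as w ≠ 1 this forces Z = 0 by
-- induction on the degree.  The theorem is then the recurrence for T.

open import Defs
open import Algebra.Bundles using (CommutativeRing; RawRing)
import Algebra.Properties.Ring as RingProperties
import Algebra.Solver.Ring.AlmostCommutativeRing as ACR
open import Data.Integer as ℤ using (ℤ; +_; -[1+_]; _⊖_; _◃_; sign; ∣_∣)
import Data.Integer.Properties as ℤ
open import Data.Maybe using (Maybe; just; nothing)
open import Data.Nat as ℕ using (ℕ; zero; suc; _∸_; _!; z≤n; s≤s)
import Data.Nat.Properties as ℕ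
open import Data.Product using (_×_; _,_)
open import Data.Sign as Sign using (Sign)
open import Level using (_⊔_)
open import Relation.Binary.PropositionalEquality as ≡ using (_≡_)
open import Relation.Nullary using (¬_; yes; no)

module IntegerCoefficients {c ℓ} (R : CommutativeRing c ℓ) where
  open CommutativeRing R
  open RingProperties ring using (-0#≈0#; -‿involutive; -‿+-comm; -1*x≈-x)
  open import Relation.Binary.Reasoning.Setoid setoid

  ofℕ-+ : ∀ m n → ofℕ R (m ℕ.+ n) ≈ ofℕ R m + ofℕ R n
  ofℕ-+ zero    n = sym (+-identityˡ _)
  ofℕ-+ (suc m) n = trans (+-congˡ (ofℕ-+ m n)) (sym (+-assoc _ _ _))

  ofℕ-* : ∀ m n → ofℕ R (m ℕ.* n) ≈ ofℕ R m * ofℕ R n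
  ofℕ-* zero    n = sym (zeroˡ _)
  ofℕ-* (suc m) n = begin
    ofℕ R (n ℕ.+ m ℕ.* n)           ≈⟨ ofℕ-+ n (m ℕ.* n) ⟩
    ofℕ R n + ofℕ R (m ℕ.* n)       ≈⟨ +-cong (sym (*-identityˡ _)) (ofℕ-* m n) ⟩
    1# * ofℕ R n + ofℕ R m * ofℕ R n ≈⟨ distribʳ _ _ _ ⟨
    (1# + ofℕ R m) * ofℕ R n        ∎

  ofℤ : ℤ → Carrier
  ofℤ (+ n)    = ofℕ R n
  ofℤ -[1+ n ] = - ofℕ R (suc n)

  ofℤ-⊖ : ∀ m n → ofℤ (m ⊖ n) ≈ ofℕ R m - ofℕ R n
  ofℤ-⊖ m zero = begin
    ofℤ (m ⊖ 0)   ≡⟨ ≡.cong ofℤ (ℤ.≤-⊖ (z≤n {m})) ⟩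
    ofℕ R m       ≈⟨ +-identityʳ _ ⟨
    ofℕ R m + 0#  ≈⟨ +-congˡ -0#≈0# ⟨
    ofℕ R m - 0#  ∎
  ofℤ-⊖ zero    (suc n) = sym (+-identityˡ _)
  ofℤ-⊖ (suc m) (suc n) = begin
    ofℤ (suc m ⊖ suc n)                      ≡⟨ ≡.cong ofℤ (ℤ.[1+m]⊖[1+n]≡m⊖n m n) ⟩
    ofℤ (m ⊖ n)                              ≈⟨ ofℤ-⊖ m n ⟩
    ofℕ R m - ofℕ R n                        ≈⟨ +-identityˡ _ ⟨
    0# + (ofℕ R m - ofℕ R n)                 ≈⟨ +-congʳ (-‿inverseʳ 1#) ⟨
    (1# - 1#) + (ofℕ R m - ofℕ R n)          ≈⟨ +-assoc _ _ _ ⟩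
    1# + (- 1# + (ofℕ R m - ofℕ R n))        ≈⟨ +-congˡ (sym (+-assoc _ _ _)) ⟩
    1# + ((- 1# + ofℕ R m) - ofℕ R n)        ≈⟨ +-congˡ (+-congʳ (+-comm _ _)) ⟩
    1# + ((ofℕ R m - 1#) - ofℕ R n)          ≈⟨ +-congˡ (+-assoc _ _ _) ⟩
    1# + (ofℕ R m + (- 1# - ofℕ R n))        ≈⟨ +-assoc _ _ _ ⟨
    (1# + ofℕ R m) + (- 1# - ofℕ R n)        ≈⟨ +-congˡ (-‿+-comm _ _) ⟩
    (1# + ofℕ R m) - (1# + ofℕ R n)          ∎

  ofℤ-+ : ∀ i j → ofℤ (i ℤ.+ j) ≈ ofℤ i + ofℤ j
  ofℤ-+ (+ m)    (+ n)    = ofℕ-+ m n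
  ofℤ-+ (+ m)    -[1+ n ] = ofℤ-⊖ m (suc n)
  ofℤ-+ -[1+ m ] (+ n)    = trans (ofℤ-⊖ n (suc m)) (+-comm _ _)
  ofℤ-+ -[1+ m ] -[1+ n ] = begin
    - (1# + ofℕ R (suc m ℕ.+ n))        ≈⟨ -‿cong (+-congˡ (ofℕ-+ (suc m) n)) ⟩
    - (1# + (ofℕ R (suc m) + ofℕ R n))  ≈⟨ -‿cong (+-congˡ (+-comm _ _)) ⟩
    - (1# + (ofℕ R n + ofℕ R (suc m)))  ≈⟨ -‿cong (+-assoc _ _ _) ⟨
    - (ofℕ R (suc n) + ofℕ R (suc m))   ≈⟨ -‿cong (+-comm _ _) ⟩
    - (ofℕ R (suc m) + ofℕ R (suc n))   ≈⟨ -‿+-comm _ _ ⟨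
    - ofℕ R (suc m) - ofℕ R (suc n)     ∎

  ofℤ-neg : ∀ i → ofℤ (ℤ.- i) ≈ - ofℤ i
  ofℤ-neg (+ zero)  = sym -0#≈0#
  ofℤ-neg (+ suc n) = refl
  ofℤ-neg -[1+ n ]  = sym (-‿involutive _)

  ofSign : Sign → Carrier
  ofSign Sign.+ = 1#
  ofSign Sign.- = - 1#

  ofSign-* : ∀ s t → ofSign (s Sign.* t) ≈ ofSign s * ofSign t
  ofSign-* Sign.- Sign.- = sym (trans (-1*x≈-x _) (-‿involutive _))
  ofSign-* Sign.- Sign.+ = sym (*-identityʳ _)
  ofSign-* Sign.+ t      = sym (*-identityˡ _)

  ofℤ-◃ : ∀ s n → ofℤ (s ◃ n) ≈ ofSign s * ofℕ R n
  ofℤ-◃ s      zero    = sym (zeroʳ _)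
  ofℤ-◃ Sign.+ (suc n) = sym (*-identityˡ _)
  ofℤ-◃ Sign.- (suc n) = sym (-1*x≈-x _)

  ofℤ-* : ∀ i j → ofℤ (i ℤ.* j) ≈ ofℤ i * ofℤ j
  ofℤ-* i j = begin
    ofℤ (sign i Sign.* sign j ◃ ∣ i ∣ ℕ.* ∣ j ∣)
      ≈⟨ ofℤ-◃ (sign i Sign.* sign j) (∣ i ∣ ℕ.* ∣ j ∣) ⟩
    ofSign (sign i Sign.* sign j) * ofℕ R (∣ i ∣ ℕ.* ∣ j ∣)
      ≈⟨ *-cong (ofSign-* (sign i) (sign j)) (ofℕ-* ∣ i ∣ ∣ j ∣) ⟩
    (ofSign (sign i) * ofSign (sign j)) * (ofℕ R ∣ i ∣ * ofℕ R ∣ j ∣)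
      ≈⟨ *-interchange _ _ _ _ ⟩
    (ofSign (sign i) * ofℕ R ∣ i ∣) * (ofSign (sign j) * ofℕ R ∣ j ∣)
      ≈⟨ *-cong (ofℤ-◃ (sign i) ∣ i ∣) (ofℤ-◃ (sign j) ∣ j ∣) ⟨
    ofℤ (sign i ◃ ∣ i ∣) * ofℤ (sign j ◃ ∣ j ∣)
      ≡⟨ ≡.cong₂ (λ i j → ofℤ i * ofℤ j) (ℤ.◃-inverse i) (ℤ.◃-inverse j) ⟩
    ofℤ i * ofℤ j ∎
    where open import Algebra.Properties.CommutativeSemigroup *-commutativeSemigroup
            renaming (interchange to *-interchange)

  -- Variants of `ofℕ R` and `ofℤ` sending 1 to 1# itself rather than 1# + 0#,
  -- so that the solver constant `con (+ 1)` is definitionally 1#.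
  ofℕ′ : ℕ → Carrier
  ofℕ′ zero          = 0#
  ofℕ′ (suc zero)    = 1#
  ofℕ′ (suc (suc n)) = 1# + ofℕ′ (suc n)

  ofℕ′≈ofℕ : ∀ n → ofℕ′ n ≈ ofℕ R n
  ofℕ′≈ofℕ zero          = refl
  ofℕ′≈ofℕ (suc zero)    = sym (+-identityʳ 1#)
  ofℕ′≈ofℕ (suc (suc n)) = +-congˡ (ofℕ′≈ofℕ (suc n))

  ⟦_⟧ℤ : ℤ → Carrier
  ⟦ + n ⟧ℤ      = ofℕ′ n
  ⟦ -[1+ n ] ⟧ℤ = - ofℕ′ (suc n)

  ⟦⟧ℤ≈ofℤ : ∀ i → ⟦ i ⟧ℤ ≈ ofℤ i
  ⟦⟧ℤ≈ofℤ (+ n)    = ofℕ′≈ofℕ n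
  ⟦⟧ℤ≈ofℤ -[1+ n ] = -‿cong (ofℕ′≈ofℕ (suc n))

  ℤ-rawRing : RawRing _ _
  ℤ-rawRing = record
    { Carrier = ℤ ; _≈_ = _≡_ ; _+_ = ℤ._+_ ; _*_ = ℤ._*_ ; -_ = ℤ.-_ ; 0# = + 0 ; 1# = + 1 }

  ⟦⟧ℤ-homomorphism : ℤ-rawRing ACR.-Raw-AlmostCommutative⟶ ACR.fromCommutativeRing R
  ⟦⟧ℤ-homomorphism = record
    { ⟦_⟧    = ⟦_⟧ℤ
    ; +-homo = λ i j → trans (⟦⟧ℤ≈ofℤ (i ℤ.+ j)) (trans (ofℤ-+ i j) (sym (+-cong (⟦⟧ℤ≈ofℤ i) (⟦⟧ℤ≈ofℤ j))))
    ; *-homo = λ i j → trans (⟦⟧ℤ≈ofℤ (i ℤ.* j)) (trans (ofℤ-* i j) (sym (*-cong (⟦⟧ℤ≈ofℤ i) (⟦⟧ℤ≈ofℤ j))))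
    ; -‿homo = λ i → trans (⟦⟧ℤ≈ofℤ (ℤ.- i)) (trans (ofℤ-neg i) (-‿cong (sym (⟦⟧ℤ≈ofℤ i))))
    ; 0-homo = refl
    ; 1-homo = refl
    }

  ⟦⟧ℤ-weaklyDecidable : ∀ i j → Maybe (⟦ i ⟧ℤ ≈ ⟦ j ⟧ℤ)
  ⟦⟧ℤ-weaklyDecidable i j with i ℤ.≟ j
  ... | yes ≡.refl = just refl
  ... | no _       = nothing

  open import Algebra.Solver.Ring ℤ-rawRing (ACR.fromCommutativeRing R) ⟦⟧ℤ-homomorphism ⟦⟧ℤ-weaklyDecidable public

  :0 :1 : ∀ {n} → Polynomial n
  :0 = con (+ 0)
  :1 = con (+ 1)

module _ {c ℓ} (F : CharZeroField c ℓ) where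
  open CharZeroField F
  open WithField F
  open IntegerCoefficients commutativeRing
  open RingProperties ring using (-1*x≈-x; -‿distribˡ-*; x∙y⁻¹≈ε⇒x≈y)
  open import Relation.Binary.Reasoning.Setoid setoid

  NonZero : Carrier → Set ℓ
  NonZero x = ¬ (x ≈ 0#)

  x≉y⇒x-y≉0 : ∀ {x y} → ¬ (x ≈ y) → NonZero (x - y)
  x≉y⇒x-y≉0 {x} {y} x≉y x-y≈0 = x≉y (x∙y⁻¹≈ε⇒x≈y x y x-y≈0)

  *-cancelˡ : ∀ {x a b} → NonZero x → x * a ≈ x * b → a ≈ b
  *-cancelˡ {x} {a} {b} x≉0 xa≈xb = begin
    a                ≈⟨ *-identityˡ a ⟨
    1# * a           ≈⟨ *-congʳ (trans (*-comm _ _) (inverseʳ x x≉0)) ⟨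
    (x ⁻¹ * x) * a   ≈⟨ *-assoc _ _ _ ⟩
    x ⁻¹ * (x * a)   ≈⟨ *-congˡ xa≈xb ⟩
    x ⁻¹ * (x * b)   ≈⟨ *-assoc _ _ _ ⟨
    (x ⁻¹ * x) * b   ≈⟨ *-congʳ (trans (*-comm _ _) (inverseʳ x x≉0)) ⟩
    1# * b           ≈⟨ *-identityˡ b ⟩
    b                ∎

  *-nonZero : ∀ {x y} → NonZero x → NonZero y → NonZero (x * y)
  *-nonZero {x} x≉0 y≉0 xy≈0 = y≉0 (*-cancelˡ x≉0 (trans xy≈0 (sym (zeroʳ x))))

  ^-nonZero : ∀ {x} n → NonZero x → NonZero (x ^ n)
  ^-nonZero zero    x≉0 1≈0 = 0≉1 (sym 1≈0)
  ^-nonZero (suc n) x≉0     = *-nonZero x≉0 (^-nonZero n x≉0)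

  !-nonZero : ∀ n → NonZero (ofℕF (n !))
  !-nonZero zero    = charZero 0
  !-nonZero (suc n) n!≈0 = *-nonZero (charZero n) (!-nonZero n) (trans (sym (ofℕ-* (suc n) (n !))) n!≈0)

  ⁻¹-distrib-* : ∀ {x y} → NonZero x → NonZero y → (x * y) ⁻¹ ≈ x ⁻¹ * y ⁻¹
  ⁻¹-distrib-* {x} {y} x≉0 y≉0 = *-cancelˡ xy≉0 (begin
    (x * y) * (x * y) ⁻¹        ≈⟨ inverseʳ _ xy≉0 ⟩
    1#                          ≈⟨ *-identityˡ _ ⟨
    1# * 1#                     ≈⟨ *-cong (inverseʳ x x≉0) (inverseʳ y y≉0) ⟨
    (x * x ⁻¹) * (y * y ⁻¹)     ≈⟨ solve 4 (λ x x' y y' → (x :* x') :* (y :* y') := (x :* y) :* (x' :* y')) refl x _ y _ ⟩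
    (x * y) * (x ⁻¹ * y ⁻¹)     ∎)
    where xy≉0 = *-nonZero x≉0 y≉0

  1+n*[1+n]!⁻¹≈n!⁻¹ : ∀ n → ofℕF (suc n) * ofℕF (suc n !) ⁻¹ ≈ ofℕF (n !) ⁻¹
  1+n*[1+n]!⁻¹≈n!⁻¹ n = begin
    ofℕF (suc n) * ofℕF (suc n !) ⁻¹                   ≈⟨ *-congˡ (⁻¹-cong (ofℕ-* (suc n) (n !))) ⟩
    ofℕF (suc n) * (ofℕF (suc n) * ofℕF (n !)) ⁻¹      ≈⟨ *-congˡ (⁻¹-distrib-* (charZero n) (!-nonZero n)) ⟩
    ofℕF (suc n) * (ofℕF (suc n) ⁻¹ * ofℕF (n !) ⁻¹)   ≈⟨ *-assoc _ _ _ ⟨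
    (ofℕF (suc n) * ofℕF (suc n) ⁻¹) * ofℕF (n !) ⁻¹   ≈⟨ *-congʳ (inverseʳ _ (charZero n)) ⟩
    1# * ofℕF (n !) ⁻¹                                 ≈⟨ *-identityˡ _ ⟩
    ofℕF (n !) ⁻¹                                      ∎

  0!⁻¹≈1 : ofℕF (0 !) ⁻¹ ≈ 1#
  0!⁻¹≈1 = trans (sym (*-identityˡ _)) (trans (*-congʳ (sym (+-identityʳ 1#))) (inverseʳ _ (charZero 0)))

  ^-+ : ∀ x m n → x ^ (m ℕ.+ n) ≈ x ^ m * x ^ n
  ^-+ x zero    n = sym (*-identityˡ _)
  ^-+ x (suc m) n = trans (*-congˡ (^-+ x m n)) (sym (*-assoc _ _ _))

  1^n≈1 : ∀ n → 1# ^ n ≈ 1#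
  1^n≈1 zero    = refl
  1^n≈1 (suc n) = trans (*-identityˡ _) (1^n≈1 n)

  Σ-cong : ∀ {f g : ℕ → Carrier} → (∀ i → f i ≈ g i) → ∀ n → Σ< n f ≈ Σ< n g
  Σ-cong f≈g zero    = refl
  Σ-cong f≈g (suc n) = +-cong (Σ-cong f≈g n) (f≈g n)

  Σ-cong-< : ∀ {f g : ℕ → Carrier} n → (∀ i → i ℕ.< n → f i ≈ g i) → Σ< n f ≈ Σ< n g
  Σ-cong-< zero    f≈g = refl
  Σ-cong-< (suc n) f≈g = +-cong (Σ-cong-< n (λ i i<n → f≈g i (ℕ.m<n⇒m<1+n i<n))) (f≈g n ℕ.≤-refl)

  Σ-zero : ∀ {f : ℕ → Carrier} n → (∀ i → i ℕ.< n → f i ≈ 0#) → Σ< n f ≈ 0#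
  Σ-zero n f≈0 = trans (Σ-cong-< n f≈0) (Σ-const0 n)
    where
    Σ-const0 : ∀ n → Σ< n (λ _ → 0#) ≈ 0#
    Σ-const0 zero    = refl
    Σ-const0 (suc n) = trans (+-identityʳ _) (Σ-const0 n)

  Σ-distrib-+ : ∀ (f g : ℕ → Carrier) n → Σ< n (λ i → f i + g i) ≈ Σ< n f + Σ< n g
  Σ-distrib-+ f g zero    = sym (+-identityˡ 0#)
  Σ-distrib-+ f g (suc n) = trans (+-congʳ (Σ-distrib-+ f g n))
    (solve 4 (λ a b c d → (a :+ b) :+ (c :+ d) := (a :+ c) :+ (b :+ d)) refl _ _ _ _)

  *-distribˡ-Σ : ∀ x (f : ℕ → Carrier) n → x * Σ< n f ≈ Σ< n (λ i → x * f i)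
  *-distribˡ-Σ x f zero    = zeroʳ x
  *-distribˡ-Σ x f (suc n) = trans (distribˡ x _ _) (+-congʳ (*-distribˡ-Σ x f n))

  *-distribʳ-Σ : ∀ x (f : ℕ → Carrier) n → Σ< n f * x ≈ Σ< n (λ i → f i * x)
  *-distribʳ-Σ x f n = trans (*-comm _ _) (trans (*-distribˡ-Σ x f n) (Σ-cong (λ i → *-comm x (f i)) n))

  Σ-unfoldˡ : ∀ (f : ℕ → Carrier) n → Σ< (suc n) f ≈ f 0 + Σ< n (λ i → f (suc i))
  Σ-unfoldˡ f zero    = trans (+-identityˡ _) (sym (+-identityʳ _))
  Σ-unfoldˡ f (suc n) = trans (+-congʳ (Σ-unfoldˡ f n)) (+-assoc _ _ _)

  Σ-truncate : ∀ {f : ℕ → Carrier} n m → n ℕ.≤ m → (∀ i → n ℕ.≤ i → i ℕ.< m → f i ≈ 0#) →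
               Σ< m f ≈ Σ< n f
  Σ-truncate n zero    z≤n f≈0 = refl
  Σ-truncate n (suc m) n≤1+m f≈0 with n ℕ.≟ suc m
  ... | yes ≡.refl = refl
  ... | no  n≢1+m  = trans (+-cong (Σ-truncate n m n≤m (λ i n≤i i<m → f≈0 i n≤i (ℕ.m<n⇒m<1+n i<m)))
                                   (f≈0 m n≤m ℕ.≤-refl))
                           (+-identityʳ _)
    where n≤m = ℕ.m<1+n⇒m≤n (ℕ.≤∧≢⇒< n≤1+m n≢1+m)

  Σ-comm : ∀ (g : ℕ → ℕ → Carrier) n m →
           Σ< n (λ i → Σ< m (λ k → g i k)) ≈ Σ< m (λ k → Σ< n (λ i → g i k))
  Σ-comm g zero    m = sym (Σ-zero m (λ _ _ → refl))
  Σ-comm g (suc n) m = trans (+-congʳ (Σ-comm g n m)) (sym (Σ-distrib-+ _ _ m))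

  infix  4 _≋_
  infixl 6 _⊞_
  infixl 7 _·_

  _≋_ : Series → Series → Set ℓ
  f ≋ g = ∀ n → f n ≈ g n

  ≋-refl : ∀ {f} → f ≋ f
  ≋-refl n = refl

  _⊞_ : Series → Series → Series
  (f ⊞ g) n = f n + g n

  _·_ : Carrier → Series → Series
  (x · f) n = x * f n

  X : Series
  X n = δ n 1

  shiftDown : Series → Series
  shiftDown f i = f (suc i)

  shiftUp : Series → Series
  shiftUp f zero    = 0#
  shiftUp f (suc n) = f n

  ⊛-cong : ∀ {f f′ g g′} → f ≋ f′ → g ≋ g′ → f ⊛ g ≋ f′ ⊛ g′
  ⊛-cong f≋f′ g≋g′ n = Σ-cong (λ i → *-cong (f≋f′ i) (g≋g′ (n ∸ i))) (suc n)

  ⊛-congˡ : ∀ {f g g′} → g ≋ g′ → f ⊛ g ≋ f ⊛ g′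
  ⊛-congˡ {f = f} = ⊛-cong {f = f} ≋-refl

  ⊛-congʳ : ∀ {f f′ g} → f ≋ f′ → f ⊛ g ≋ f′ ⊛ g
  ⊛-congʳ {g = g} f≋f′ = ⊛-cong {g = g} f≋f′ ≋-refl

  ⊛-unfoldˡ : ∀ f g n → (f ⊛ g) (suc n) ≈ f 0 * g (suc n) + (shiftDown f ⊛ g) n
  ⊛-unfoldˡ f g n = Σ-unfoldˡ (λ i → f i * g (suc n ∸ i)) (suc n)

  ⊛-unfoldʳ : ∀ f g n → (f ⊛ g) (suc n) ≈ (f ⊛ shiftDown g) n + f (suc n) * g 0
  ⊛-unfoldʳ f g n = +-cong
    (Σ-cong-< (suc n) (λ i i≤n → *-congˡ (reflexive (≡.cong g (ℕ.+-∸-assoc 1 (ℕ.m<1+n⇒m≤n i≤n))))))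
    (*-congˡ (reflexive (≡.cong g (ℕ.n∸n≡0 n))))

  ⊛-comm : ∀ f g → f ⊛ g ≋ g ⊛ f
  ⊛-comm f g zero    = +-congˡ (*-comm _ _)
  ⊛-comm f g (suc n) = begin
    (f ⊛ g) (suc n)                                ≈⟨ ⊛-unfoldˡ f g n ⟩
    f 0 * g (suc n) + (shiftDown f ⊛ g) n          ≈⟨ +-cong (*-comm _ _) (⊛-comm (shiftDown f) g n) ⟩
    g (suc n) * f 0 + (g ⊛ shiftDown f) n          ≈⟨ +-comm _ _ ⟩
    (g ⊛ shiftDown f) n + g (suc n) * f 0          ≈⟨ ⊛-unfoldʳ g f n ⟨
    (g ⊛ f) (suc n)                                ∎

  ⊛-distribʳ : ∀ f g h → (f ⊞ g) ⊛ h ≋ (f ⊛ h) ⊞ (g ⊛ h)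
  ⊛-distribʳ f g h n = trans (Σ-cong (λ i → distribʳ _ _ _) (suc n)) (Σ-distrib-+ _ _ (suc n))

  ⊛-distribˡ : ∀ f g h → h ⊛ (f ⊞ g) ≋ (h ⊛ f) ⊞ (h ⊛ g)
  ⊛-distribˡ f g h n = trans (Σ-cong (λ i → distribˡ _ _ _) (suc n)) (Σ-distrib-+ _ _ (suc n))

  ⊛-scaleˡ : ∀ x f g → (x · f) ⊛ g ≋ x · (f ⊛ g)
  ⊛-scaleˡ x f g n = trans (Σ-cong (λ i → *-assoc _ _ _) (suc n)) (sym (*-distribˡ-Σ x _ (suc n)))

  ⊛-scaleʳ : ∀ x f g → f ⊛ (x · g) ≋ x · (f ⊛ g)
  ⊛-scaleʳ x f g n = trans (Σ-cong (λ i → x*-comm (f i) (g (n ∸ i))) (suc n)) (sym (*-distribˡ-Σ x _ (suc n)))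
    where
    x*-comm : ∀ a b → a * (x * b) ≈ x * (a * b)
    x*-comm a b = solve 3 (λ a b x → a :* (x :* b) := x :* (a :* b)) refl a b x

  ⊛-assoc : ∀ f g h → (f ⊛ g) ⊛ h ≋ f ⊛ (g ⊛ h)
  ⊛-assoc f g h zero    = solve 3 (λ a b c → :0 :+ (:0 :+ a :* b) :* c := :0 :+ a :* (:0 :+ b :* c)) refl (f 0) (g 0) (h 0)
  ⊛-assoc f g h (suc n) = begin
    ((f ⊛ g) ⊛ h) (suc n)
      ≈⟨ ⊛-unfoldˡ (f ⊛ g) h n ⟩
    (f ⊛ g) 0 * h (suc n) + (shiftDown (f ⊛ g) ⊛ h) n
      ≈⟨ +-congˡ (⊛-congʳ {g = h} (⊛-unfoldˡ f g) n) ⟩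
    (f ⊛ g) 0 * h (suc n) + (((f 0 · shiftDown g) ⊞ (shiftDown f ⊛ g)) ⊛ h) n
      ≈⟨ +-congˡ (⊛-distribʳ _ _ h n) ⟩
    (f ⊛ g) 0 * h (suc n) + (((f 0 · shiftDown g) ⊛ h) n + ((shiftDown f ⊛ g) ⊛ h) n)
      ≈⟨ +-congˡ (+-cong (⊛-scaleˡ (f 0) (shiftDown g) h n) (⊛-assoc (shiftDown f) g h n)) ⟩
    (f ⊛ g) 0 * h (suc n) + (f 0 * (shiftDown g ⊛ h) n + (shiftDown f ⊛ (g ⊛ h)) n)
      ≈⟨ solve 5 (λ a b c d e → (:0 :+ a :* b) :* c :+ (a :* d :+ e) := a :* (b :* c :+ d) :+ e) refl _ _ _ _ _ ⟩
    f 0 * (g 0 * h (suc n) + (shiftDown g ⊛ h) n) + (shiftDown f ⊛ (g ⊛ h)) n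
      ≈⟨ +-congʳ (*-congˡ (⊛-unfoldˡ g h n)) ⟨
    f 0 * (g ⊛ h) (suc n) + (shiftDown f ⊛ (g ⊛ h)) n
      ≈⟨ ⊛-unfoldˡ f (g ⊛ h) n ⟨
    (f ⊛ (g ⊛ h)) (suc n) ∎

  ⊛-identityˡ : ∀ f → oneS ⊛ f ≋ f
  ⊛-identityˡ f zero    = trans (+-identityˡ _) (*-identityˡ _)
  ⊛-identityˡ f (suc n) = begin
    (oneS ⊛ f) (suc n)                          ≈⟨ ⊛-unfoldˡ oneS f n ⟩
    1# * f (suc n) + (shiftDown oneS ⊛ f) n     ≈⟨ +-cong (*-identityˡ _) (Σ-zero (suc n) (λ i _ → zeroˡ _)) ⟩
    f (suc n) + 0#                              ≈⟨ +-identityʳ _ ⟩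
    f (suc n)                                   ∎

  ⊛-identityʳ : ∀ f → f ⊛ oneS ≋ f
  ⊛-identityʳ f n = trans (⊛-comm f oneS n) (⊛-identityˡ f n)

  X-⊛ : ∀ f → X ⊛ f ≋ shiftUp f
  X-⊛ f zero    = trans (+-identityˡ _) (zeroˡ _)
  X-⊛ f (suc n) = trans (⊛-unfoldˡ X f n) (trans (+-cong (zeroˡ _) (⊛-identityˡ f n)) (+-identityˡ _))

  powS-vanishes : ∀ e → e 0 ≈ 0# → ∀ k n → n ℕ.< k → powS e k n ≈ 0#
  powS-vanishes e e0≈0 (suc k) n n<1+k = Σ-zero (suc n) term≈0
    where
    term≈0 : ∀ i → i ℕ.< suc n → e i * powS e k (n ∸ i) ≈ 0#
    term≈0 zero    _       = trans (*-congʳ e0≈0) (zeroˡ _)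
    term≈0 (suc i) 1+i≤1+n = trans (*-congˡ (powS-vanishes e e0≈0 k (n ∸ suc i) n∸[1+i]<k)) (zeroʳ _)
      where
      n∸[1+i]<k = ℕ.<-≤-trans (ℕ.∸-monoʳ-< {n} {suc i} {0} (s≤s z≤n) (ℕ.m<1+n⇒m≤n 1+i≤1+n))
                              (ℕ.m<1+n⇒m≤n n<1+k)

  D : Series → Series
  D f n = ofℕF (suc n) * f (suc n)

  D-cong : ∀ {f g} → f ≋ g → D f ≋ D g
  D-cong f≋g n = *-congˡ (f≋g (suc n))

  D-⊛ : ∀ f g → D (f ⊛ g) ≋ (D f ⊛ g) ⊞ (f ⊛ D g)
  D-⊛ f g n = begin
    ofℕF (suc n) * Σ< (2 ℕ.+ n) (λ i → f i * g (suc n ∸ i))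
      ≈⟨ *-distribˡ-Σ _ _ (2 ℕ.+ n) ⟩
    Σ< (2 ℕ.+ n) (λ i → ofℕF (suc n) * (f i * g (suc n ∸ i)))
      ≈⟨ Σ-cong-< (2 ℕ.+ n) (λ i i< → split i (ℕ.m<1+n⇒m≤n i<)) ⟩
    Σ< (2 ℕ.+ n) (λ i → Df-term i + Dg-term i)
      ≈⟨ Σ-distrib-+ Df-term Dg-term (2 ℕ.+ n) ⟩
    Σ< (2 ℕ.+ n) Df-term + Σ< (2 ℕ.+ n) Dg-term
      ≈⟨ +-cong Df-part Dg-part ⟩
    (D f ⊛ g) n + (f ⊛ D g) n ∎
    where
    Df-term Dg-term : ℕ → Carrier
    Df-term i = (ofℕF i * f i) * g (suc n ∸ i)
    Dg-term i = f i * (ofℕF (suc n ∸ i) * g (suc n ∸ i))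

    split : ∀ i → i ℕ.≤ suc n → ofℕF (suc n) * (f i * g (suc n ∸ i)) ≈ Df-term i + Dg-term i
    split i i≤1+n = begin
      ofℕF (suc n) * (f i * g (suc n ∸ i))
        ≡⟨ ≡.cong (λ m → ofℕF m * (f i * g (suc n ∸ i))) (ℕ.m+[n∸m]≡n i≤1+n) ⟨
      ofℕF (i ℕ.+ (suc n ∸ i)) * (f i * g (suc n ∸ i))
        ≈⟨ *-congʳ (ofℕ-+ i (suc n ∸ i)) ⟩
      (ofℕF i + ofℕF (suc n ∸ i)) * (f i * g (suc n ∸ i))
        ≈⟨ solve 4 (λ a b x y → (a :+ b) :* (x :* y) := (a :* x) :* y :+ x :* (b :* y)) refl _ _ (f i) _ ⟩
      Df-term i + Dg-term i ∎

    Df-part : Σ< (2 ℕ.+ n) Df-term ≈ (D f ⊛ g) n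
    Df-part = begin
      Σ< (2 ℕ.+ n) Df-term                    ≈⟨ Σ-unfoldˡ Df-term (suc n) ⟩
      (0# * f 0) * g (suc n) + (D f ⊛ g) n    ≈⟨ +-congʳ (trans (*-congʳ (zeroˡ _)) (zeroˡ _)) ⟩
      0# + (D f ⊛ g) n                        ≈⟨ +-identityˡ _ ⟩
      (D f ⊛ g) n                             ∎

    Dg-part : Σ< (2 ℕ.+ n) Dg-term ≈ (f ⊛ D g) n
    Dg-part = begin
      Σ< (suc n) Dg-term + f (suc n) * (ofℕF (suc n ∸ suc n) * g (suc n ∸ suc n))
        ≡⟨ ≡.cong (λ m → Σ< (suc n) Dg-term + f (suc n) * (ofℕF m * g m)) (ℕ.n∸n≡0 n) ⟩
      Σ< (suc n) Dg-term + f (suc n) * (0# * g 0)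
        ≈⟨ +-congˡ (trans (*-congˡ (zeroˡ _)) (zeroʳ _)) ⟩
      Σ< (suc n) Dg-term + 0#
        ≈⟨ +-identityʳ _ ⟩
      Σ< (suc n) Dg-term
        ≈⟨ Σ-cong-< (suc n) (λ i i≤n → reflexive (≡.cong (λ m → f i * (ofℕF m * g m)) (ℕ.+-∸-assoc 1 (ℕ.m<1+n⇒m≤n i≤n)))) ⟩
      (f ⊛ D g) n ∎

  module Substitution (e : Series) (e0≈0 : e 0 ≈ 0#) where

    -- the composite a ∘ e; only k ≤ n contributes to the n-th coefficient
    compose : Series → Series
    compose a n = Σ≤ n (λ k → a k * powS e k n)

    compose-extend : ∀ a N n → n ℕ.≤ N → Σ≤ N (λ k → a k * powS e k n) ≈ compose a n
    compose-extend a N n n≤N = Σ-truncate (suc n) (suc N) (s≤s n≤N)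
      (λ k n<k _ → trans (*-congˡ (powS-vanishes e e0≈0 k n n<k)) (zeroʳ _))

    compose-cong : ∀ {a b} → a ≋ b → compose a ≋ compose b
    compose-cong a≋b n = Σ-cong (λ k → *-congʳ (a≋b k)) (suc n)

    compose-scale : ∀ x a → compose (x · a) ≋ x · compose a
    compose-scale x a n = trans (Σ-cong (λ k → *-assoc _ _ _) (suc n)) (sym (*-distribˡ-Σ x _ (suc n)))

    compose-⊞ : ∀ a b → compose (a ⊞ b) ≋ compose a ⊞ compose b
    compose-⊞ a b n = trans (Σ-cong (λ k → distribʳ _ _ _) (suc n)) (Σ-distrib-+ _ _ (suc n))

    ⊛-compose : ∀ a → e ⊛ compose a ≋ compose (shiftUp a)
    ⊛-compose a n = sym (begin
      compose (shiftUp a) n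
        ≈⟨ Σ-unfoldˡ _ n ⟩
      0# * powS e 0 n + Σ< n (λ j → a j * powS e (suc j) n)
        ≈⟨ trans (+-congʳ (zeroˡ _)) (+-identityˡ _) ⟩
      Σ< n (λ j → a j * powS e (suc j) n)
        ≈⟨ trans (+-congˡ (trans (*-congˡ (powS-vanishes e e0≈0 (suc n) n ℕ.≤-refl)) (zeroʳ _))) (+-identityʳ _) ⟨
      Σ≤ n (λ j → a j * (e ⊛ powS e j) n)
        ≈⟨ Σ-cong (λ j → *-distribˡ-Σ (a j) _ (suc n)) (suc n) ⟩
      Σ≤ n (λ j → Σ≤ n (λ i → a j * (e i * powS e j (n ∸ i))))
        ≈⟨ Σ-comm _ (suc n) (suc n) ⟩
      Σ≤ n (λ i → Σ≤ n (λ j → a j * (e i * powS e j (n ∸ i))))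
        ≈⟨ Σ-cong (λ i → Σ-cong (λ j → solve 3 (λ a x y → a :* (x :* y) := x :* (a :* y)) refl (a j) (e i) _) (suc n)) (suc n) ⟩
      Σ≤ n (λ i → Σ≤ n (λ j → e i * (a j * powS e j (n ∸ i))))
        ≈⟨ Σ-cong (λ i → *-distribˡ-Σ (e i) _ (suc n)) (suc n) ⟨
      Σ≤ n (λ i → e i * Σ≤ n (λ j → a j * powS e j (n ∸ i)))
        ≈⟨ Σ-cong (λ i → *-congˡ (compose-extend a n (n ∸ i) (ℕ.m∸n≤m n i))) (suc n) ⟩
      (e ⊛ compose a) n ∎)

    D-powS : ∀ k → D (powS e (suc k)) ≋ ofℕF (suc k) · (powS e k ⊛ D e)
    D-powS zero n = begin
      D (e ⊛ oneS) n          ≈⟨ D-cong (⊛-identityʳ e) n ⟩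
      D e n                   ≈⟨ ⊛-identityˡ (D e) n ⟨
      (oneS ⊛ D e) n          ≈⟨ *-identityˡ _ ⟨
      1# * (oneS ⊛ D e) n     ≈⟨ *-congʳ (+-identityʳ 1#) ⟨
      ofℕF 1 * (oneS ⊛ D e) n ∎
    D-powS (suc k) n = begin
      D (e ⊛ eᵏ⁺¹) n
        ≈⟨ D-⊛ e eᵏ⁺¹ n ⟩
      (D e ⊛ eᵏ⁺¹) n + (e ⊛ D eᵏ⁺¹) n
        ≈⟨ +-cong (⊛-comm (D e) eᵏ⁺¹ n) (⊛-congˡ (D-powS k) n) ⟩
      (eᵏ⁺¹ ⊛ D e) n + (e ⊛ (ofℕF (suc k) · (powS e k ⊛ D e))) n
        ≈⟨ +-congˡ (⊛-scaleʳ (ofℕF (suc k)) e (powS e k ⊛ D e) n) ⟩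
      (eᵏ⁺¹ ⊛ D e) n + ofℕF (suc k) * (e ⊛ (powS e k ⊛ D e)) n
        ≈⟨ +-congˡ (*-congˡ (⊛-assoc e (powS e k) (D e) n)) ⟨
      (eᵏ⁺¹ ⊛ D e) n + ofℕF (suc k) * (eᵏ⁺¹ ⊛ D e) n
        ≈⟨ trans (distribʳ _ _ _) (+-congʳ (*-identityˡ _)) ⟨
      ofℕF (2 ℕ.+ k) * (eᵏ⁺¹ ⊛ D e) n ∎
      where eᵏ⁺¹ = powS e (suc k)

    D-compose : ∀ a → D (compose a) ≋ compose (D a) ⊛ D e
    D-compose a n = begin
      ofℕF (suc n) * Σ≤ (suc n) (λ k → a k * powS e k (suc n))
        ≈⟨ *-distribˡ-Σ _ _ (2 ℕ.+ n) ⟩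
      Σ≤ (suc n) (λ k → ofℕF (suc n) * (a k * powS e k (suc n)))
        ≈⟨ Σ-cong (λ k → solve 3 (λ x a p → x :* (a :* p) := a :* (x :* p)) refl _ (a k) _) (2 ℕ.+ n) ⟩
      Σ≤ (suc n) (λ k → a k * D (powS e k) n)
        ≈⟨ Σ-unfoldˡ _ (suc n) ⟩
      a 0 * (ofℕF (suc n) * 0#) + Σ≤ n (λ j → a (suc j) * D (powS e (suc j)) n)
        ≈⟨ +-cong (trans (*-congˡ (zeroʳ _)) (zeroʳ _)) (Σ-cong (λ j → *-congˡ (D-powS j n)) (suc n)) ⟩
      0# + Σ≤ n (λ j → a (suc j) * (ofℕF (suc j) * (powS e j ⊛ D e) n))
        ≈⟨ +-identityˡ _ ⟩
      Σ≤ n (λ j → a (suc j) * (ofℕF (suc j) * (powS e j ⊛ D e) n))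
        ≈⟨ Σ-cong (λ j → solve 3 (λ a x p → a :* (x :* p) := (x :* a) :* p) refl (a (suc j)) _ _) (suc n) ⟩
      Σ≤ n (λ j → D a j * (powS e j ⊛ D e) n)
        ≈⟨ Σ-cong (λ j → *-distribˡ-Σ (D a j) _ (suc n)) (suc n) ⟩
      Σ≤ n (λ j → Σ≤ n (λ i → D a j * (powS e j i * D e (n ∸ i))))
        ≈⟨ Σ-comm _ (suc n) (suc n) ⟩
      Σ≤ n (λ i → Σ≤ n (λ j → D a j * (powS e j i * D e (n ∸ i))))
        ≈⟨ Σ-cong (λ i → Σ-cong (λ j → sym (*-assoc _ _ _)) (suc n)) (suc n) ⟩
      Σ≤ n (λ i → Σ≤ n (λ j → (D a j * powS e j i) * D e (n ∸ i)))
        ≈⟨ Σ-cong (λ i → *-distribʳ-Σ _ _ (suc n)) (suc n) ⟨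
      Σ≤ n (λ i → Σ≤ n (λ j → D a j * powS e j i) * D e (n ∸ i))
        ≈⟨ Σ-cong-< (suc n) (λ i i≤n → *-congʳ (compose-extend (D a) n i (ℕ.m<1+n⇒m≤n i≤n))) ⟩
      (compose (D a) ⊛ D e) n ∎

  ratFact-suc-suc : ∀ r k → ratFact (suc r) (suc k) ≈ ratFact (suc r) k + ofℕF (suc r) * ratFact r (suc k)
  ratFact-suc-suc r k = begin
    ofℕF (suc (r ℕ.+ suc k) !) * ofℕF (suc k !) ⁻¹
      ≈⟨ *-congʳ (ofℕ-* (suc (r ℕ.+ suc k)) ((r ℕ.+ suc k) !)) ⟩
    (ofℕF (suc r ℕ.+ suc k) * [r+1+k]!) * ofℕF (suc k !) ⁻¹
      ≈⟨ *-congʳ (*-congʳ (trans (reflexive (≡.cong ofℕF (ℕ.+-comm (suc r) (suc k)))) (ofℕ-+ (suc k) (suc r)))) ⟩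
    ((ofℕF (suc k) + ofℕF (suc r)) * [r+1+k]!) * ofℕF (suc k !) ⁻¹
      ≈⟨ solve 4 (λ a b g i → ((a :+ b) :* g) :* i := g :* (a :* i) :+ b :* (g :* i)) refl _ _ _ _ ⟩
    [r+1+k]! * (ofℕF (suc k) * ofℕF (suc k !) ⁻¹) + ofℕF (suc r) * ratFact r (suc k)
      ≈⟨ +-congʳ (*-cong (reflexive (≡.cong (λ j → ofℕF (j !)) (ℕ.+-suc r k))) (1+n*[1+n]!⁻¹≈n!⁻¹ k)) ⟩
    ratFact (suc r) k + ofℕF (suc r) * ratFact r (suc k) ∎
    where [r+1+k]! = ofℕF ((r ℕ.+ suc k) !)

  ratFact-sucˡ : ∀ r k → ratFact (suc r) k ≈ ofℕF (suc k) * ratFact r (suc k)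
  ratFact-sucˡ r k = sym (begin
    ofℕF (suc k) * (ofℕF ((r ℕ.+ suc k) !) * ofℕF (suc k !) ⁻¹)
      ≈⟨ solve 3 (λ a g i → a :* (g :* i) := g :* (a :* i)) refl _ _ _ ⟩
    ofℕF ((r ℕ.+ suc k) !) * (ofℕF (suc k) * ofℕF (suc k !) ⁻¹)
      ≈⟨ *-cong (reflexive (≡.cong (λ j → ofℕF (j !)) (ℕ.+-suc r k))) (1+n*[1+n]!⁻¹≈n!⁻¹ k) ⟩
    ratFact (suc r) k ∎)

  -- For e with e 0 = 0, the series q r below is r! / (α - τ e)^(r+1), and Q is α - τ e.
  module InversePowers (e : Series) (e0≈0 : e 0 ≈ 0#) (α τ : Carrier) (α≉0 : NonZero α) where
    open Substitution e e0≈0 public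

    α⁻ : ℕ → Carrier
    α⁻ n = (α ^ n) ⁻¹

    α*α⁻-suc : ∀ n → α * α⁻ (suc n) ≈ α⁻ n
    α*α⁻-suc n = begin
      α * (α * α ^ n) ⁻¹       ≈⟨ *-congˡ (⁻¹-distrib-* α≉0 (^-nonZero n α≉0)) ⟩
      α * (α ⁻¹ * α⁻ n)        ≈⟨ *-assoc _ _ _ ⟨
      (α * α ⁻¹) * α⁻ n        ≈⟨ *-congʳ (inverseʳ α α≉0) ⟩
      1# * α⁻ n                ≈⟨ *-identityˡ _ ⟩
      α⁻ n                     ∎

    α⁻-cong : ∀ {m n} → m ≡ n → α⁻ m ≈ α⁻ n
    α⁻-cong m≡n = reflexive (≡.cong α⁻ m≡n)

    coeff : ℕ → Series
    coeff r k = ((τ ^ k) ÷ (α ^ (r ℕ.+ k ℕ.+ 1))) * ratFact r k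

    q : ℕ → Series
    q r = compose (coeff r)

    Q : Series
    Q = α · oneS ⊞ (- τ) · e

    private
      exponent-suc : ∀ r k → r ℕ.+ suc k ℕ.+ 1 ≡ suc (r ℕ.+ k ℕ.+ 1)
      exponent-suc r k = ≡.cong (ℕ._+ 1) (ℕ.+-suc r k)

    coeff-recurrence : ∀ r → α · coeff (suc r) ⊞ (- τ) · shiftUp (coeff (suc r)) ≋ ofℕF (suc r) · coeff r
    coeff-recurrence r zero = begin
      α * ((1# * α⁻ (suc (r ℕ.+ 0 ℕ.+ 1))) * ratFact (suc r) 0) + (- τ) * 0#
        ≈⟨ trans (+-congˡ (zeroʳ _)) (+-identityʳ _) ⟩
      α * ((1# * α⁻ (suc (r ℕ.+ 0 ℕ.+ 1))) * ratFact (suc r) 0)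
        ≈⟨ solve 3 (λ x p r → x :* ((:1 :* p) :* r) := (:1 :* (x :* p)) :* r) refl α _ _ ⟩
      (1# * (α * α⁻ (suc (r ℕ.+ 0 ℕ.+ 1)))) * ratFact (suc r) 0
        ≈⟨ *-cong (*-congˡ (α*α⁻-suc (r ℕ.+ 0 ℕ.+ 1))) (*-congʳ (ofℕ-* (suc (r ℕ.+ 0)) ((r ℕ.+ 0) !))) ⟩
      (1# * α⁻ (r ℕ.+ 0 ℕ.+ 1)) * ((ofℕF (suc (r ℕ.+ 0)) * ofℕF ((r ℕ.+ 0) !)) * ofℕF (0 !) ⁻¹)
        ≡⟨ ≡.cong (λ m → (1# * α⁻ (r ℕ.+ 0 ℕ.+ 1)) * ((ofℕF (suc m) * ofℕF ((r ℕ.+ 0) !)) * ofℕF (0 !) ⁻¹)) (ℕ.+-identityʳ r) ⟩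
      (1# * α⁻ (r ℕ.+ 0 ℕ.+ 1)) * ((ofℕF (suc r) * ofℕF ((r ℕ.+ 0) !)) * ofℕF (0 !) ⁻¹)
        ≈⟨ solve 4 (λ p s f i → (:1 :* p) :* ((s :* f) :* i) := s :* ((:1 :* p) :* (f :* i))) refl _ _ _ _ ⟩
      ofℕF (suc r) * coeff r 0 ∎
    coeff-recurrence r (suc k) = begin
      α * ((τ * τ ^ k * α⁻ᵃ) * ratFact (suc r) (suc k)) + (- τ) * ((τ ^ k * α⁻ᵇ) * ratFact (suc r) k)
        ≈⟨ solve 7 (λ x τ t a A b B → x :* ((τ :* t :* a) :* A) :+ (:- τ) :* ((t :* b) :* B)
                                  := τ :* t :* ((x :* a) :* A) :- τ :* (t :* b :* B)) refl α τ _ _ _ _ _ ⟩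
      τ * τ ^ k * ((α * α⁻ᵃ) * ratFact (suc r) (suc k)) - τ * (τ ^ k * α⁻ᵇ * ratFact (suc r) k)
        ≈⟨ +-congʳ (*-congˡ (*-cong (trans (α*α⁻-suc (r ℕ.+ suc k ℕ.+ 1)) (α⁻-cong (exponent-suc r k))) (ratFact-suc-suc r k))) ⟩
      τ * τ ^ k * (α⁻ᵇ * (ratFact (suc r) k + ofℕF (suc r) * ratFact r (suc k))) - τ * (τ ^ k * α⁻ᵇ * ratFact (suc r) k)
        ≈⟨ solve 6 (λ τ t b B s C → τ :* t :* (b :* (B :+ s :* C)) :- τ :* (t :* b :* B)
                                := s :* ((τ :* t :* b) :* C)) refl τ _ _ _ _ _ ⟩
      ofℕF (suc r) * ((τ * τ ^ k * α⁻ᵇ) * ratFact r (suc k))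
        ≈⟨ *-congˡ (*-congʳ (*-congˡ (α⁻-cong (exponent-suc r k)))) ⟨
      ofℕF (suc r) * coeff r (suc k) ∎
      where
      α⁻ᵃ = α⁻ (suc (r ℕ.+ suc k ℕ.+ 1))
      α⁻ᵇ = α⁻ (suc (r ℕ.+ k ℕ.+ 1))

    D-coeff : ∀ r → D (coeff r) ≋ τ · coeff (suc r)
    D-coeff r k = begin
      ofℕF (suc k) * ((τ * τ ^ k * α⁻ (r ℕ.+ suc k ℕ.+ 1)) * ratFact r (suc k))
        ≈⟨ solve 5 (λ s τ t p C → s :* ((τ :* t :* p) :* C) := τ :* ((t :* p) :* (s :* C))) refl _ τ _ _ _ ⟩
      τ * ((τ ^ k * α⁻ (r ℕ.+ suc k ℕ.+ 1)) * (ofℕF (suc k) * ratFact r (suc k)))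
        ≈⟨ *-congˡ (*-cong (*-congˡ (α⁻-cong (exponent-suc r k))) (sym (ratFact-sucˡ r k))) ⟩
      τ * coeff (suc r) k ∎

    Q-⊛-q : ∀ r → Q ⊛ q (suc r) ≋ ofℕF (suc r) · q r
    Q-⊛-q r n = begin
      (Q ⊛ q (suc r)) n
        ≈⟨ ⊛-distribʳ (α · oneS) ((- τ) · e) (q (suc r)) n ⟩
      ((α · oneS) ⊛ q (suc r)) n + (((- τ) · e) ⊛ q (suc r)) n
        ≈⟨ +-cong (⊛-scaleˡ α oneS (q (suc r)) n) (⊛-scaleˡ (- τ) e (q (suc r)) n) ⟩
      α * (oneS ⊛ q (suc r)) n + (- τ) * (e ⊛ q (suc r)) n
        ≈⟨ +-cong (*-congˡ (⊛-identityˡ (q (suc r)) n)) (*-congˡ (⊛-compose (coeff (suc r)) n)) ⟩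
      α * q (suc r) n + (- τ) * compose (shiftUp (coeff (suc r))) n
        ≈⟨ +-cong (compose-scale α (coeff (suc r)) n) (compose-scale (- τ) (shiftUp (coeff (suc r))) n) ⟨
      compose (α · coeff (suc r)) n + compose ((- τ) · shiftUp (coeff (suc r))) n
        ≈⟨ compose-⊞ _ _ n ⟨
      compose (α · coeff (suc r) ⊞ (- τ) · shiftUp (coeff (suc r))) n
        ≈⟨ compose-cong (coeff-recurrence r) n ⟩
      compose (ofℕF (suc r) · coeff r) n
        ≈⟨ compose-scale (ofℕF (suc r)) (coeff r) n ⟩
      ofℕF (suc r) * q r n ∎

    D-q : ∀ r → D (q r) ≋ τ · (D e ⊛ q (suc r))
    D-q r n = begin
      D (q r) n                           ≈⟨ D-compose (coeff r) n ⟩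
      (compose (D (coeff r)) ⊛ D e) n     ≈⟨ ⊛-congʳ {g = D e} (compose-cong (D-coeff r)) n ⟩
      (compose (τ · coeff (suc r)) ⊛ D e) n ≈⟨ ⊛-congʳ {g = D e} (compose-scale τ (coeff (suc r))) n ⟩
      ((τ · q (suc r)) ⊛ D e) n           ≈⟨ ⊛-scaleˡ τ (q (suc r)) (D e) n ⟩
      τ * (q (suc r) ⊛ D e) n             ≈⟨ *-congˡ (⊛-comm (q (suc r)) (D e) n) ⟩
      τ * (D e ⊛ q (suc r)) n             ∎

    D-Q : D Q ≋ (- τ) · D e
    D-Q n = solve 4 (λ s x τ y → s :* (x :* :0 :+ (:- τ) :* y) := (:- τ) :* (s :* y)) refl (ofℕF (suc n)) α τ (e (suc n))

    -- the derivative of x Q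
    W : Series
    W = Q ⊞ X ⊛ D Q

    q-⊛-D-Q : ∀ r → q (suc r) ⊛ D Q ≋ (- 1#) · D (q r)
    q-⊛-D-Q r n = begin
      (q (suc r) ⊛ D Q) n             ≈⟨ ⊛-congˡ D-Q n ⟩
      (q (suc r) ⊛ ((- τ) · D e)) n   ≈⟨ ⊛-scaleʳ (- τ) (q (suc r)) (D e) n ⟩
      (- τ) * (q (suc r) ⊛ D e) n     ≈⟨ *-congˡ (⊛-comm (q (suc r)) (D e) n) ⟩
      (- τ) * (D e ⊛ q (suc r)) n     ≈⟨ trans (sym (-‿distribˡ-* τ _)) (sym (-1*x≈-x _)) ⟩
      (- 1#) * (τ * (D e ⊛ q (suc r)) n) ≈⟨ *-congˡ (D-q r n) ⟨
      (- 1#) * D (q r) n              ∎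

    q-⊛-W : ∀ r → q (suc r) ⊛ W ≋ ofℕF (suc r) · q r ⊞ X ⊛ ((- 1#) · D (q r))
    q-⊛-W r n = begin
      (q′ ⊛ W) n                               ≈⟨ ⊛-distribˡ Q (X ⊛ D Q) q′ n ⟩
      (q′ ⊛ Q) n + (q′ ⊛ (X ⊛ D Q)) n          ≈⟨ +-cong (trans (⊛-comm q′ Q n) (Q-⊛-q r n)) (sym (⊛-assoc q′ X (D Q) n)) ⟩
      ofℕF (suc r) * q r n + ((q′ ⊛ X) ⊛ D Q) n ≈⟨ +-congˡ (⊛-congʳ {g = D Q} (⊛-comm q′ X) n) ⟩
      ofℕF (suc r) * q r n + ((X ⊛ q′) ⊛ D Q) n ≈⟨ +-congˡ (⊛-assoc X q′ (D Q) n) ⟩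
      ofℕF (suc r) * q r n + (X ⊛ (q′ ⊛ D Q)) n ≈⟨ +-congˡ (⊛-congˡ (q-⊛-D-Q r) n) ⟩
      ofℕF (suc r) * q r n + (X ⊛ ((- 1#) · D (q r))) n ∎
      where q′ = q (suc r)

    -- By the Leibniz rule, the coefficient of x^(r+1) in ((r+1) q r - x D (q r)) ⊛ N
    -- is the coefficient of x^r in q r ⊛ D N.
    transfer : ∀ w M′ M N → w · M′ ≋ M ⊞ W ⊛ N → ∀ r →
               w * (q (suc r) ⊛ M′) (suc r) ≈ (q (suc r) ⊛ M) (suc r) + (q r ⊛ D N) r
    transfer w M′ M N wM′≋M+WN r = begin
      w * (q′ ⊛ M′) (suc r)
        ≈⟨ ⊛-scaleʳ w q′ M′ (suc r) ⟨
      (q′ ⊛ (w · M′)) (suc r)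
        ≈⟨ ⊛-congˡ wM′≋M+WN (suc r) ⟩
      (q′ ⊛ (M ⊞ W ⊛ N)) (suc r)
        ≈⟨ ⊛-distribˡ M (W ⊛ N) q′ (suc r) ⟩
      (q′ ⊛ M) (suc r) + (q′ ⊛ (W ⊛ N)) (suc r)
        ≈⟨ +-congˡ (⊛-assoc q′ W N (suc r)) ⟨
      (q′ ⊛ M) (suc r) + ((q′ ⊛ W) ⊛ N) (suc r)
        ≈⟨ +-congˡ (trans (⊛-congʳ {g = N} (q-⊛-W r) (suc r)) (⊛-distribʳ _ _ N (suc r))) ⟩
      (q′ ⊛ M) (suc r) + (((ofℕF (suc r) · q r) ⊛ N) (suc r) + ((X ⊛ ((- 1#) · D (q r))) ⊛ N) (suc r))
        ≈⟨ +-congˡ (+-cong (⊛-scaleˡ (ofℕF (suc r)) (q r) N (suc r)) shifted) ⟩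
      (q′ ⊛ M) (suc r) + (D (q r ⊛ N) r + (- 1#) * (D (q r) ⊛ N) r)
        ≈⟨ +-congˡ (+-congʳ (D-⊛ (q r) N r)) ⟩
      (q′ ⊛ M) (suc r) + (((D (q r) ⊛ N) r + (q r ⊛ D N) r) + (- 1#) * (D (q r) ⊛ N) r)
        ≈⟨ +-congˡ (solve 2 (λ y z → (y :+ z) :+ (:- :1) :* y := z) refl _ _) ⟩
      (q′ ⊛ M) (suc r) + (q r ⊛ D N) r ∎
      where
      q′ = q (suc r)
      shifted : ((X ⊛ ((- 1#) · D (q r))) ⊛ N) (suc r) ≈ (- 1#) * (D (q r) ⊛ N) r
      shifted = begin
        ((X ⊛ ((- 1#) · D (q r))) ⊛ N) (suc r) ≈⟨ ⊛-assoc X ((- 1#) · D (q r)) N (suc r) ⟩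
        (X ⊛ (((- 1#) · D (q r)) ⊛ N)) (suc r) ≈⟨ X-⊛ (((- 1#) · D (q r)) ⊛ N) (suc r) ⟩
        (((- 1#) · D (q r)) ⊛ N) r             ≈⟨ ⊛-scaleˡ (- 1#) (D (q r)) N r ⟩
        (- 1#) * (D (q r) ⊛ N) r               ∎

  expS : Carrier → Series
  expS v n = (v ^ n) ÷ ofℕF (n !)

  expS-0 : ∀ v → expS v 0 ≈ 1#
  expS-0 v = trans (*-congˡ 0!⁻¹≈1) (*-identityˡ 1#)

  D-expS : ∀ v → D (expS v) ≋ v · expS v
  D-expS v n = begin
    ofℕF (suc n) * ((v * v ^ n) * ofℕF (suc n !) ⁻¹)
      ≈⟨ solve 4 (λ s v t i → s :* ((v :* t) :* i) := v :* (t :* (s :* i))) refl _ v _ _ ⟩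
    v * (v ^ n * (ofℕF (suc n) * ofℕF (suc n !) ⁻¹))
      ≈⟨ *-congˡ (*-congˡ (1+n*[1+n]!⁻¹≈n!⁻¹ n)) ⟩
    v * expS v n ∎

  expS-unique : ∀ f x → D f ≋ x · f → f 0 ≈ 1# → f ≋ expS x
  expS-unique f x Df≋xf f0≈1 zero    = trans f0≈1 (sym (expS-0 x))
  expS-unique f x Df≋xf f0≈1 (suc n) = *-cancelˡ (charZero n) (begin
    ofℕF (suc n) * f (suc n)         ≈⟨ Df≋xf n ⟩
    x * f n                          ≈⟨ *-congˡ (expS-unique f x Df≋xf f0≈1 n) ⟩
    x * expS x n                     ≈⟨ D-expS x n ⟨
    ofℕF (suc n) * expS x (suc n)    ∎)

  expS-⊛-expS1 : ∀ v → expS v ⊛ expS 1# ≋ expS (v + 1#)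
  expS-⊛-expS1 v = expS-unique (expS v ⊛ expS 1#) (v + 1#) D-product product-0
    where
    D-product : D (expS v ⊛ expS 1#) ≋ (v + 1#) · (expS v ⊛ expS 1#)
    D-product n = begin
      D (expS v ⊛ expS 1#) n
        ≈⟨ D-⊛ (expS v) (expS 1#) n ⟩
      (D (expS v) ⊛ expS 1#) n + (expS v ⊛ D (expS 1#)) n
        ≈⟨ +-cong (⊛-congʳ {g = expS 1#} (D-expS v) n) (⊛-congˡ (D-expS 1#) n) ⟩
      ((v · expS v) ⊛ expS 1#) n + (expS v ⊛ (1# · expS 1#)) n
        ≈⟨ +-cong (⊛-scaleˡ v (expS v) (expS 1#) n) (⊛-scaleʳ 1# (expS v) (expS 1#) n) ⟩
      v * (expS v ⊛ expS 1#) n + 1# * (expS v ⊛ expS 1#) n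
        ≈⟨ distribʳ _ _ _ ⟨
      (v + 1#) * (expS v ⊛ expS 1#) n ∎
    product-0 : (expS v ⊛ expS 1#) 0 ≈ 1#
    product-0 = trans (+-identityˡ _) (trans (*-cong (expS-0 v) (expS-0 1#)) (*-identityˡ 1#))

  -- Here x Q = w (eˣ - 1) - x, so W = w eˣ - 1.
  module ExponentialSide (w : Carrier) (w-1≉0 : NonZero (w - 1#)) where
    open InversePowers (seriesOf invFact) refl (w - 1#) (- w) w-1≉0 public

    w·expS1≋1+W : w · expS 1# ≋ oneS ⊞ W
    w·expS1≋1+W zero = begin
      w * expS 1# 0                           ≈⟨ trans (*-congˡ (expS-0 1#)) (*-identityʳ w) ⟩
      w                                       ≈⟨ solve 1 (λ w → w := :1 :+ (((w :- :1) :* :1 :+ (:- (:- w)) :* :0) :+ :0)) refl w ⟩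
      1# + (Q 0 + 0#)                         ≈⟨ +-congˡ (+-congˡ (X-⊛ (D Q) 0)) ⟨
      1# + (Q 0 + (X ⊛ D Q) 0)                ∎
    w·expS1≋1+W (suc m) = begin
      w * expS 1# (suc m)
        ≈⟨ *-congˡ (*-congʳ (1^n≈1 (suc m))) ⟩
      w * (1# * ofℕF (suc m !) ⁻¹)
        ≈⟨ *-congˡ (*-congˡ (1+n*[1+n]!⁻¹≈n!⁻¹ (suc m))) ⟨
      w * (1# * (ofℕF (2 ℕ.+ m) * ofℕF (suc (suc m) !) ⁻¹))
        ≈⟨ solve 3 (λ w s i → w :* (:1 :* ((:1 :+ s) :* i))
                             := :0 :+ ((w :- :1) :* :0 :+ (:- (:- w)) :* (:1 :* i) :+ (:- (:- w)) :* (s :* (:1 :* i))))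
                   refl w (ofℕF (suc m)) _ ⟩
      0# + (Q (suc m) + (- (- w)) * D (seriesOf invFact) m)
        ≈⟨ +-congˡ (+-congˡ (trans (X-⊛ (D Q) (suc m)) (D-Q m))) ⟨
      0# + (Q (suc m) + (X ⊛ D Q) (suc m)) ∎

    w·expS-+1 : ∀ v → w · expS (v + 1#) ≋ expS v ⊞ W ⊛ expS v
    w·expS-+1 v n = begin
      w * expS (v + 1#) n                    ≈⟨ *-congˡ (expS-⊛-expS1 v n) ⟨
      w * (expS v ⊛ expS 1#) n               ≈⟨ ⊛-scaleʳ w (expS v) (expS 1#) n ⟨
      (expS v ⊛ (w · expS 1#)) n             ≈⟨ ⊛-congˡ w·expS1≋1+W n ⟩
      (expS v ⊛ (oneS ⊞ W)) n                ≈⟨ ⊛-distribˡ oneS W (expS v) n ⟩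
      (expS v ⊛ oneS) n + (expS v ⊛ W) n     ≈⟨ +-cong (⊛-identityʳ (expS v) n) (⊛-comm (expS v) W n) ⟩
      expS v n + (W ⊛ expS v) n              ∎

    T : ℕ → Carrier → Carrier
    T r v = (q r ⊛ expS v) r

    T-recurrence : ∀ r v → w * T (suc r) (v + 1#) ≈ T (suc r) v + v * T r v
    T-recurrence r v = begin
      w * T (suc r) (v + 1#)              ≈⟨ transfer w (expS (v + 1#)) (expS v) (expS v) (w·expS-+1 v) r ⟩
      T (suc r) v + (q r ⊛ D (expS v)) r  ≈⟨ +-congˡ (trans (⊛-congˡ (D-expS v) r) (⊛-scaleʳ v (q r) (expS v) r)) ⟩
      T (suc r) v + v * T r v             ∎

  fallingProd-+1 : ∀ v m → fallingProd (v + 1#) (suc m) ≈ (v + 1#) * fallingProd v m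
  fallingProd-+1 v zero    = solve 1 (λ v → :1 :* ((v :+ :1) :- :0) := (v :+ :1) :* :1) refl v
  fallingProd-+1 v (suc m) = begin
    fallingProd (v + 1#) (suc m) * ((v + 1#) - ofℕF (suc m))
      ≈⟨ *-congʳ (fallingProd-+1 v m) ⟩
    ((v + 1#) * fallingProd v m) * ((v + 1#) - (1# + ofℕF m))
      ≈⟨ solve 3 (λ v f s → ((v :+ :1) :* f) :* ((v :+ :1) :- (:1 :+ s)) := (v :+ :1) :* (f :* (v :- s))) refl v _ _ ⟩
    (v + 1#) * fallingProd v (suc m) ∎

  binom-pascal : ∀ v m → binom (v + 1#) (suc m) ≈ binom v (suc m) + binom v m
  binom-pascal v m = begin
    fallingProd (v + 1#) (suc m) * ofℕF (suc m !) ⁻¹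
      ≈⟨ *-congʳ (fallingProd-+1 v m) ⟩
    ((v + 1#) * fallingProd v m) * ofℕF (suc m !) ⁻¹
      ≈⟨ solve 4 (λ v f m i → ((v :+ :1) :* f) :* i := (f :* (v :- m)) :* i :+ f :* ((:1 :+ m) :* i)) refl v _ (ofℕF m) _ ⟩
    binom v (suc m) + fallingProd v m * (ofℕF (suc m) * ofℕF (suc m !) ⁻¹)
      ≈⟨ +-congˡ (*-congˡ (1+n*[1+n]!⁻¹≈n!⁻¹ m)) ⟩
    binom v (suc m) + binom v m ∎

  binomS : Carrier → Series
  binomS v n = (- 1#) ^ n * binom v n

  1-X : Series
  1-X = oneS ⊞ (- 1#) · X

  geometric : Series
  geometric n = 1#

  1-X-⊛ : ∀ f → 1-X ⊛ f ≋ f ⊞ (- 1#) · shiftUp f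
  1-X-⊛ f n = trans (⊛-distribʳ oneS ((- 1#) · X) f n)
                    (+-cong (⊛-identityˡ f n) (trans (⊛-scaleˡ (- 1#) X f n) (*-congˡ (X-⊛ f n))))

  binomS-+1 : ∀ v → binomS (v + 1#) ≋ 1-X ⊛ binomS v
  binomS-+1 v zero    = sym (trans (1-X-⊛ (binomS v) 0)
    (solve 1 (λ i → :1 :* (:1 :* i) :+ (:- :1) :* :0 := :1 :* (:1 :* i)) refl (ofℕF (0 !) ⁻¹)))
  binomS-+1 v (suc m) = begin
    (- 1# * (- 1#) ^ m) * binom (v + 1#) (suc m)
      ≈⟨ *-congˡ (binom-pascal v m) ⟩
    (- 1# * (- 1#) ^ m) * (binom v (suc m) + binom v m)
      ≈⟨ solve 3 (λ t b c → ((:- :1) :* t) :* (b :+ c) := ((:- :1) :* t) :* b :+ (:- :1) :* (t :* c)) refl _ _ _ ⟩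
    binomS v (suc m) + (- 1#) * binomS v m
      ≈⟨ 1-X-⊛ (binomS v) (suc m) ⟨
    (1-X ⊛ binomS v) (suc m) ∎

  geometric-⊛-1-X : geometric ⊛ 1-X ≋ oneS
  geometric-⊛-1-X zero    = trans (⊛-comm geometric 1-X 0)
    (trans (1-X-⊛ geometric 0) (solve 0 (:1 :+ (:- :1) :* :0 := :1) refl))
  geometric-⊛-1-X (suc m) = trans (⊛-comm geometric 1-X (suc m))
    (trans (1-X-⊛ geometric (suc m)) (solve 0 (:1 :+ (:- :1) :* :1 := :0) refl))

  D-binomS : ∀ v → D (binomS (v + 1#)) ≋ (- (v + 1#)) · binomS v
  D-binomS v m = begin
    ofℕF (suc m) * ((- 1# * (- 1#) ^ m) * (fallingProd (v + 1#) (suc m) * ofℕF (suc m !) ⁻¹))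
      ≈⟨ *-congˡ (*-congˡ (*-congʳ (fallingProd-+1 v m))) ⟩
    ofℕF (suc m) * ((- 1# * (- 1#) ^ m) * (((v + 1#) * fallingProd v m) * ofℕF (suc m !) ⁻¹))
      ≈⟨ solve 5 (λ s t v f i → s :* (((:- :1) :* t) :* (((v :+ :1) :* f) :* i))
                             := (:- (v :+ :1)) :* (t :* (f :* (s :* i)))) refl _ _ v _ _ ⟩
    (- (v + 1#)) * ((- 1#) ^ m * (fallingProd v m * (ofℕF (suc m) * ofℕF (suc m !) ⁻¹)))
      ≈⟨ *-congˡ (*-congˡ (*-congˡ (1+n*[1+n]!⁻¹≈n!⁻¹ m))) ⟩
    (- (v + 1#)) * binomS v m ∎

  -- Here x Q = w x + log (1 - x), so W = w - 1/(1 - x).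
  module BinomialSide (w : Carrier) (w-1≉0 : NonZero (w - 1#)) where
    open InversePowers (seriesOf harm) refl (w - 1#) 1# w-1≉0 public

    W≋w-geometric : W ≋ w · oneS ⊞ (- 1#) · geometric
    W≋w-geometric zero = begin
      Q 0 + (X ⊛ D Q) 0      ≈⟨ +-congˡ (X-⊛ (D Q) 0) ⟩
      Q 0 + 0#               ≈⟨ solve 1 (λ w → ((w :- :1) :* :1 :+ (:- :1) :* :0) :+ :0 := w :* :1 :+ (:- :1) :* :1) refl w ⟩
      w * 1# + (- 1#) * 1#   ∎
    W≋w-geometric (suc m) = begin
      Q (suc m) + (X ⊛ D Q) (suc m)
        ≈⟨ +-congˡ (trans (X-⊛ (D Q) (suc m)) (D-Q m)) ⟩
      Q (suc m) + (- 1#) * D (seriesOf harm) m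
        ≈⟨ solve 3 (λ w s i → ((w :- :1) :* :0 :+ (:- :1) :* (:1 :* i)) :+ (:- :1) :* (s :* (:1 :* i))
                             := (:- :1) :* ((:1 :+ s) :* i)) refl w (ofℕF (suc m)) _ ⟩
      (- 1#) * (ofℕF (2 ℕ.+ m) * ofℕF (2 ℕ.+ m) ⁻¹)
        ≈⟨ *-congˡ (inverseʳ _ (charZero (suc m))) ⟩
      (- 1#) * 1#
        ≈⟨ solve 1 (λ w → (:- :1) :* :1 := w :* :0 :+ (:- :1) :* :1) refl w ⟩
      w * 0# + (- 1#) * 1# ∎

    w·binomS-+1 : ∀ v → w · binomS (v + 1#) ≋ binomS v ⊞ W ⊛ binomS (v + 1#)
    w·binomS-+1 v n = begin
      w * B′ n
        ≈⟨ solve 2 (λ x y → x := y :+ (x :+ (:- :1) :* y)) refl _ _ ⟩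
      binomS v n + (w * B′ n + (- 1#) * binomS v n)
        ≈⟨ +-congˡ (+-cong (trans (⊛-scaleˡ w oneS B′ n) (*-congˡ (⊛-identityˡ B′ n)))
                           (trans (⊛-scaleˡ (- 1#) geometric B′ n) (*-congˡ geometric-⊛-B′))) ⟨
      binomS v n + (((w · oneS) ⊛ B′) n + (((- 1#) · geometric) ⊛ B′) n)
        ≈⟨ +-congˡ (⊛-distribʳ (w · oneS) ((- 1#) · geometric) B′ n) ⟨
      binomS v n + ((w · oneS ⊞ (- 1#) · geometric) ⊛ B′) n
        ≈⟨ +-congˡ (⊛-congʳ {g = B′} W≋w-geometric n) ⟨
      binomS v n + (W ⊛ B′) n ∎
      where
      B′ = binomS (v + 1#)
      geometric-⊛-B′ : (geometric ⊛ B′) n ≈ binomS v n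
      geometric-⊛-B′ = begin
        (geometric ⊛ B′) n             ≈⟨ ⊛-congˡ (binomS-+1 v) n ⟩
        (geometric ⊛ (1-X ⊛ binomS v)) n ≈⟨ ⊛-assoc geometric 1-X (binomS v) n ⟨
        ((geometric ⊛ 1-X) ⊛ binomS v) n ≈⟨ ⊛-congʳ {g = binomS v} geometric-⊛-1-X n ⟩
        (oneS ⊛ binomS v) n             ≈⟨ ⊛-identityˡ (binomS v) n ⟩
        binomS v n                      ∎

    R : ℕ → Carrier → Carrier
    R r v = (- 1#) ^ r * (q r ⊛ binomS v) r

    R-recurrence : ∀ r v → w * R (suc r) (v + 1#) ≈ R (suc r) v + (v + 1#) * R r v
    R-recurrence r v = begin
      w * ((- 1# * (- 1#) ^ r) * (q (suc r) ⊛ binomS (v + 1#)) (suc r))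
        ≈⟨ solve 3 (λ w t A → w :* (((:- :1) :* t) :* A) := ((:- :1) :* t) :* (w :* A)) refl w _ _ ⟩
      (- 1# * (- 1#) ^ r) * (w * (q (suc r) ⊛ binomS (v + 1#)) (suc r))
        ≈⟨ *-congˡ (transfer w (binomS (v + 1#)) (binomS v) (binomS (v + 1#)) (w·binomS-+1 v) r) ⟩
      (- 1# * (- 1#) ^ r) * ((q (suc r) ⊛ binomS v) (suc r) + (q r ⊛ D (binomS (v + 1#))) r)
        ≈⟨ *-congˡ (+-congˡ (trans (⊛-congˡ (D-binomS v) r) (⊛-scaleʳ _ (q r) (binomS v) r))) ⟩
      (- 1# * (- 1#) ^ r) * ((q (suc r) ⊛ binomS v) (suc r) + (- (v + 1#)) * (q r ⊛ binomS v) r)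
        ≈⟨ solve 4 (λ t B v C → ((:- :1) :* t) :* (B :+ (:- (v :+ :1)) :* C)
                             := ((:- :1) :* t) :* B :+ (v :+ :1) :* (t :* C)) refl _ _ v _ ⟩
      R (suc r) v + (v + 1#) * R r v ∎

  Δ : (Carrier → Carrier) → Carrier → Carrier
  Δ f u = f (u + 1#) - f u

  -- A weak form of "degree ≤ d" that suffices here: Δᵈ f is 1-periodic.
  DegreeAtMost : ℕ → (Carrier → Carrier) → Set (c ⊔ ℓ)
  DegreeAtMost zero    f = ∀ u → f (u + 1#) ≈ f u
  DegreeAtMost (suc d) f = DegreeAtMost d (Δ f)

  degree-resp : ∀ d {f g} → (∀ u → f u ≈ g u) → DegreeAtMost d f → DegreeAtMost d g
  degree-resp zero    f≈g deg u = trans (sym (f≈g _)) (trans (deg u) (f≈g u))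
  degree-resp (suc d) f≈g deg   = degree-resp d (λ u → +-cong (f≈g _) (-‿cong (f≈g u))) deg

  degree-const : ∀ d k → DegreeAtMost d (λ _ → k)
  degree-const zero    k u = refl
  degree-const (suc d) k   = degree-resp d (λ u → sym (-‿inverseʳ k)) (degree-const d 0#)

  degree-+ : ∀ d {f g} → DegreeAtMost d f → DegreeAtMost d g → DegreeAtMost d (λ u → f u + g u)
  degree-+ zero    degf degg u = +-cong (degf u) (degg u)
  degree-+ (suc d) {f} {g} degf degg = degree-resp d
    (λ u → solve 4 (λ a b c e → (a :- b) :+ (c :- e) := (a :+ c) :- (b :+ e)) refl (f (u + 1#)) (f u) (g (u + 1#)) (g u))
    (degree-+ d degf degg)

  degree-scale : ∀ d k {f} → DegreeAtMost d f → DegreeAtMost d (λ u → k * f u)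
  degree-scale zero    k     deg u = *-congˡ (deg u)
  degree-scale (suc d) k {f} deg   = degree-resp d
    (λ u → solve 3 (λ k a b → k :* (a :- b) := k :* a :- k :* b) refl k (f (u + 1#)) (f u))
    (degree-scale d k deg)

  degree-Σ : ∀ d n {g : ℕ → Carrier → Carrier} → (∀ m → DegreeAtMost d (g m)) →
             DegreeAtMost d (λ u → Σ< n (λ m → g m u))
  degree-Σ d zero    deg = degree-const d 0#
  degree-Σ d (suc n) deg = degree-+ d (degree-Σ d n deg) (deg n)

  degree-suc : ∀ d {f} → DegreeAtMost d f → DegreeAtMost (suc d) f
  degree-suc zero {f} deg u = trans (Δf≈0 (u + 1#)) (sym (Δf≈0 u))
    where
    Δf≈0 : ∀ u → Δ f u ≈ 0#
    Δf≈0 u = trans (+-congʳ (deg u)) (-‿inverseʳ _)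
  degree-suc (suc d) deg = degree-suc d deg

  degree-mono : ∀ {j d f} → j ℕ.≤ d → DegreeAtMost j f → DegreeAtMost d f
  degree-mono {d = zero}  z≤n       deg = deg
  degree-mono {d = suc d} z≤n       deg = degree-suc d (degree-mono {d = d} z≤n deg)
  degree-mono             (s≤s j≤d) deg = degree-mono j≤d deg

  degree-shift : ∀ d {f} → DegreeAtMost d f → DegreeAtMost d (λ u → f (u + 1#))
  degree-shift zero    deg u = deg (u + 1#)
  degree-shift (suc d) deg   = degree-shift d deg

  degree-linear-* : ∀ d a {f} → DegreeAtMost d f → DegreeAtMost (suc d) (λ u → (u + a) * f u)
  degree-linear-* d a {f} deg = degree-resp d (λ u → sym (Δ-product u)) (go d deg)
    where
    Δ-product : ∀ u → ((u + 1#) + a) * f (u + 1#) - (u + a) * f u ≈ (u + a) * Δ f u + f (u + 1#)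
    Δ-product u = solve 4 (λ u a x y → ((u :+ :1) :+ a) :* x :- (u :+ a) :* y := (u :+ a) :* (x :- y) :+ x) refl u a _ _
    go : ∀ d′ → DegreeAtMost d′ f → DegreeAtMost d′ (λ u → (u + a) * Δ f u + f (u + 1#))
    go zero     deg′ = degree-resp 0
      (λ u → sym (trans (+-congʳ (trans (*-congˡ (trans (+-congʳ (deg′ u)) (-‿inverseʳ _))) (zeroʳ _))) (+-identityˡ _)))
      (degree-shift 0 deg′)
    go (suc d′) deg′ = degree-+ (suc d′) (degree-linear-* d′ a deg′) (degree-shift (suc d′) deg′)

  degree-^ : ∀ j → DegreeAtMost j (λ u → (u + 1#) ^ j)
  degree-^ zero    = degree-const 0 1#
  degree-^ (suc j) = degree-linear-* j 1# (degree-^ j)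

  degree-fallingProd : ∀ j → DegreeAtMost j (λ u → fallingProd u j)
  degree-fallingProd zero    = degree-const 0 1#
  degree-fallingProd (suc j) = degree-resp (suc j) (λ u → *-comm _ _)
    (degree-linear-* j (- ofℕF j) (degree-fallingProd j))

  module _ (w : Carrier) (w-1≉0 : NonZero (w - 1#)) where

    periodic-solution-zero : ∀ (Z : Carrier → Carrier) → (∀ u → Z (u + 1#) ≈ Z u) →
                             (∀ u → w * Z (u + 1#) ≈ Z u) → ∀ u → Z u ≈ 0#
    periodic-solution-zero Z periodic wZ≈Z u = trans (sym (periodic u)) (*-cancelˡ w-1≉0 (begin
      (w - 1#) * Z (u + 1#)       ≈⟨ solve 2 (λ w z → (w :- :1) :* z := w :* z :- z) refl w _ ⟩
      w * Z (u + 1#) - Z (u + 1#) ≈⟨ +-cong (wZ≈Z u) (-‿cong (periodic u)) ⟩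
      Z u - Z u                   ≈⟨ -‿inverseʳ _ ⟩
      0#                          ≈⟨ zeroʳ _ ⟨
      (w - 1#) * 0#               ∎))

    -- Δ commutes with the functional equation, so induction on d reduces it to the periodic case.
    polynomial-solution-zero : ∀ d (Z : Carrier → Carrier) → DegreeAtMost d Z →
                               (∀ u → w * Z (u + 1#) ≈ Z u) → ∀ u → Z u ≈ 0#
    polynomial-solution-zero zero    Z deg wZ≈Z = periodic-solution-zero Z deg wZ≈Z
    polynomial-solution-zero (suc d) Z deg wZ≈Z = periodic-solution-zero Z periodic wZ≈Z
      where
      wΔZ≈ΔZ : ∀ u → w * Δ Z (u + 1#) ≈ Δ Z u
      wΔZ≈ΔZ u = trans (solve 3 (λ w a b → w :* (a :- b) := w :* a :- w :* b) refl w _ _)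
                       (+-cong (wZ≈Z (u + 1#)) (-‿cong (wZ≈Z u)))
      periodic : ∀ u → Z (u + 1#) ≈ Z u
      periodic u = trans (solve 2 (λ a b → a := (a :- b) :+ b) refl _ _)
                         (trans (+-congʳ (polynomial-solution-zero d (Δ Z) deg wΔZ≈ΔZ u)) (+-identityˡ _))

  degree-binomS : ∀ j → DegreeAtMost j (λ u → binomS u j)
  degree-binomS j = degree-scale j _ (degree-resp j (λ u → *-comm _ _)
    (degree-scale j (ofℕF (j !) ⁻¹) (degree-fallingProd j)))

  degree-expS-+1 : ∀ j → DegreeAtMost j (λ u → expS (u + 1#) j)
  degree-expS-+1 j = degree-resp j (λ u → *-comm _ _) (degree-scale j (ofℕF (j !) ⁻¹) (degree-^ j))

  -1^r*-1^[r∸m]≈-1^m : ∀ m r → m ℕ.≤ r → (- 1#) ^ r * (- 1#) ^ (r ∸ m) ≈ (- 1#) ^ m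
  -1^r*-1^[r∸m]≈-1^m m r m≤r = begin
    (- 1#) ^ r * (- 1#) ^ (r ∸ m)                          ≡⟨ ≡.cong (λ n → (- 1#) ^ n * (- 1#) ^ (r ∸ m)) (ℕ.m+[n∸m]≡n m≤r) ⟨
    (- 1#) ^ (m ℕ.+ (r ∸ m)) * (- 1#) ^ (r ∸ m)            ≈⟨ *-congʳ (^-+ (- 1#) m (r ∸ m)) ⟩
    ((- 1#) ^ m * (- 1#) ^ (r ∸ m)) * (- 1#) ^ (r ∸ m)     ≈⟨ *-assoc _ _ _ ⟩
    (- 1#) ^ m * ((- 1#) ^ (r ∸ m) * (- 1#) ^ (r ∸ m))     ≈⟨ *-congˡ (square≈1 (r ∸ m)) ⟩
    (- 1#) ^ m * 1#                                        ≈⟨ *-identityʳ _ ⟩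
    (- 1#) ^ m                                             ∎
    where
    square≈1 : ∀ n → (- 1#) ^ n * (- 1#) ^ n ≈ 1#
    square≈1 zero    = *-identityˡ 1#
    square≈1 (suc n) = trans (solve 1 (λ t → ((:- :1) :* t) :* ((:- :1) :* t) := t :* t) refl _) (square≈1 n)

  module _ (w : Carrier) (w-1≉0 : NonZero (w - 1#)) where
    private
      module E = ExponentialSide w w-1≉0
      module B = BinomialSide w w-1≉0

    degree-R : ∀ r → DegreeAtMost r (B.R r)
    degree-R r = degree-scale r _ (degree-Σ r (suc r)
      (λ m → degree-scale r (B.q r m) (degree-mono (ℕ.m∸n≤m r m) (degree-binomS (r ∸ m)))))

    degree-T-+1 : ∀ r → DegreeAtMost r (λ u → E.T r (u + 1#))
    degree-T-+1 r = degree-Σ r (suc r)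
      (λ m → degree-scale r (E.q r m) (degree-mono (ℕ.m∸n≤m r m) (degree-expS-+1 (r ∸ m))))

    private
      [w-1]⁻¹-normalise : ((w - 1#) * 1#) ⁻¹ * (ofℕF (0 !) ⁻¹ * ofℕF (0 !) ⁻¹) ≈ (w - 1#) ⁻¹
      [w-1]⁻¹-normalise = trans (*-cong (⁻¹-cong (*-identityʳ _)) (trans (*-cong 0!⁻¹≈1 0!⁻¹≈1) (*-identityˡ 1#)))
                                (*-identityʳ _)

    R0≈[w-1]⁻¹ : ∀ u → B.R 0 u ≈ (w - 1#) ⁻¹
    R0≈[w-1]⁻¹ u = trans (solve 2 (λ p i → :1 :* (:0 :+ (:0 :+ ((:1 :* p) :* ((:1 :+ :0) :* i)) :* :1) :* (:1 :* (:1 :* i)))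
                                         := p :* (i :* i)) refl _ _)
                         [w-1]⁻¹-normalise

    T0≈[w-1]⁻¹ : ∀ u → E.T 0 u ≈ (w - 1#) ⁻¹
    T0≈[w-1]⁻¹ u = trans (solve 2 (λ p i → :0 :+ (:0 :+ ((:1 :* p) :* ((:1 :+ :0) :* i)) :* :1) :* (:1 :* i)
                                         := p :* (i :* i)) refl _ _)
                         [w-1]⁻¹-normalise

    R≈T-+1 : ∀ r u → B.R r u ≈ E.T r (u + 1#)
    R≈T-+1 zero    u = trans (R0≈[w-1]⁻¹ u) (sym (T0≈[w-1]⁻¹ (u + 1#)))
    R≈T-+1 (suc r) u = trans (solve 2 (λ a b → a := (a :- b) :+ b) refl _ _)
                             (trans (+-congʳ (polynomial-solution-zero w w-1≉0 (suc r) Z degree-Z wZ≈Z u)) (+-identityˡ _))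
      where
      Z : Carrier → Carrier
      Z u = B.R (suc r) u - E.T (suc r) (u + 1#)

      degree-Z : DegreeAtMost (suc r) Z
      degree-Z = degree-+ (suc r) (degree-R (suc r))
        (degree-resp (suc r) (λ u → -1*x≈-x _) (degree-scale (suc r) (- 1#) (degree-T-+1 (suc r))))

      wZ≈Z : ∀ u → w * Z (u + 1#) ≈ Z u
      wZ≈Z u = begin
        w * (B.R (suc r) (u + 1#) - E.T (suc r) ((u + 1#) + 1#))
          ≈⟨ solve 3 (λ w a b → w :* (a :- b) := w :* a :- w :* b) refl w _ _ ⟩
        w * B.R (suc r) (u + 1#) - w * E.T (suc r) ((u + 1#) + 1#)
          ≈⟨ +-cong (B.R-recurrence r u) (-‿cong (E.T-recurrence r (u + 1#))) ⟩
        (B.R (suc r) u + (u + 1#) * B.R r u) - (E.T (suc r) (u + 1#) + (u + 1#) * E.T r (u + 1#))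
          ≈⟨ +-congʳ (+-congˡ (*-congˡ (R≈T-+1 r u))) ⟩
        (B.R (suc r) u + (u + 1#) * E.T r (u + 1#)) - (E.T (suc r) (u + 1#) + (u + 1#) * E.T r (u + 1#))
          ≈⟨ solve 3 (λ a x c → (a :+ x) :- (c :+ x) := a :- c) refl _ _ _ ⟩
        Z u ∎

    Ũ≈-T : ∀ r v → Ũ r w v ≈ - E.T r v
    Ũ≈-T r v = -‿cong (Σ-cong (λ m → *-comm _ _) (suc r))

    U≈δ-wR : ∀ r v → U r w v ≈ δ r 0 - w * B.R r v
    U≈δ-wR r v = +-congˡ (-‿cong (sym (begin
      w * ((- 1#) ^ r * Σ≤ r (λ m → B.q r m * binomS v (r ∸ m)))
        ≈⟨ trans (*-congˡ (*-distribˡ-Σ _ _ (suc r))) (*-distribˡ-Σ _ _ (suc r)) ⟩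
      Σ≤ r (λ m → w * ((- 1#) ^ r * (B.q r m * binomS v (r ∸ m))))
        ≈⟨ Σ-cong (λ m → solve 5 (λ w s q t b → w :* (s :* (q :* (t :* b))) := ((s :* t) :* b) :* (w :* q)) refl w _ _ _ _) (suc r) ⟩
      Σ≤ r (λ m → (((- 1#) ^ r * (- 1#) ^ (r ∸ m)) * binom v (r ∸ m)) * (w * B.q r m))
        ≈⟨ Σ-cong-< (suc r) (λ m m≤r → *-cong (*-congʳ (-1^r*-1^[r∸m]≈-1^m m r (ℕ.m<1+n⇒m≤n m≤r))) (w*q≈ m)) ⟩
      Σ≤ r (λ m → ((- 1#) ^ m * binom v (r ∸ m)) *
                  Σ≤ m (λ k → (w ÷ ((w - 1#) ^ (r ℕ.+ k ℕ.+ 1))) * ratFact r k * A m k harm)) ∎)))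
      where
      w*q≈ : ∀ m → w * B.q r m ≈ Σ≤ m (λ k → (w ÷ ((w - 1#) ^ (r ℕ.+ k ℕ.+ 1))) * ratFact r k * A m k harm)
      w*q≈ m = trans (*-distribˡ-Σ w _ (suc m)) (Σ-cong (λ k → trans
        (*-congˡ (*-congʳ (*-congʳ (*-congʳ (1^n≈1 k)))))
        (solve 4 (λ w p f a → w :* (((:1 :* p) :* f) :* a) := ((w :* p) :* f) :* a) refl w _ _ _)) (suc m))

    U0≈Ũ0 : ∀ v → U 0 w v ≈ Ũ 0 w v
    U0≈Ũ0 v = begin
      U 0 w v                                 ≈⟨ U≈δ-wR 0 v ⟩
      1# - w * B.R 0 v                        ≈⟨ +-congˡ (-‿cong (*-congˡ (R0≈[w-1]⁻¹ v))) ⟩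
      1# - w * (w - 1#) ⁻¹                    ≈⟨ +-congʳ (inverseʳ _ w-1≉0) ⟨
      (w - 1#) * (w - 1#) ⁻¹ - w * (w - 1#) ⁻¹ ≈⟨ solve 2 (λ w p → (w :- :1) :* p :- w :* p := :- p) refl w _ ⟩
      - (w - 1#) ⁻¹                           ≈⟨ -‿cong (T0≈[w-1]⁻¹ v) ⟨
      - E.T 0 v                               ≈⟨ Ũ≈-T 0 v ⟨
      Ũ 0 w v                                 ∎

    U-suc≈Ũ-suc+vŨ : ∀ r v → U (suc r) w v ≈ Ũ (suc r) w v + v * Ũ r w v
    U-suc≈Ũ-suc+vŨ r v = begin
      U (suc r) w v                            ≈⟨ U≈δ-wR (suc r) v ⟩
      0# - w * B.R (suc r) v                   ≈⟨ +-congˡ (-‿cong (*-congˡ (R≈T-+1 (suc r) v))) ⟩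
      0# - w * E.T (suc r) (v + 1#)            ≈⟨ +-congˡ (-‿cong (E.T-recurrence r v)) ⟩
      0# - (E.T (suc r) v + v * E.T r v)       ≈⟨ solve 3 (λ a v b → :0 :- (a :+ v :* b) := (:- a) :+ v :* (:- b)) refl _ v _ ⟩
      - E.T (suc r) v + v * (- E.T r v)        ≈⟨ +-cong (Ũ≈-T (suc r) v) (*-congˡ (Ũ≈-T r v)) ⟨
      Ũ (suc r) w v + v * Ũ r w v              ∎

proposition6p4 : ∀ {c ℓ} (F : CharZeroField c ℓ) →
    let open CharZeroField F
        open WithField F
    in (w v : Carrier) → ¬ (w ≈ 1#) →
       (U 0 w v ≈ Ũ 0 w v) ×
       (∀ (r : ℕ) → U (suc r) w v ≈ Ũ (suc r) w v + v * Ũ r w v)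
proposition6p4 F w v w≉1 = U0≈Ũ0 F w w-1≉0 v , λ r → U-suc≈Ũ-suc+vŨ F w w-1≉0 r v
  where w-1≉0 = x≉y⇒x-y≉0 F w≉1
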